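{- Let $m$ and $n$ be positive integers, $u=n(n+1)$ and $v=\frac{n+1}{n^2}$. Then \[ 4m\,\Sigma n^{2m-1}=\sum_{j=1}^m\binom{2m}{2j-1}P^{\rm Inv}_{j-1}(u)B_{2m-2j+1}+\sum_{j=1}^m\binom{2m}{2j}Q^{\rm Inv}_j(u)B_{2m-2j}, \] \[ (4m+2)\Sigma n^{2m}=\sum_{j=1}^{m+1}\binom{2m+1}{2j-1}(2n+1)\mathcal{P}^{\rm Inv}_{j-1}(u)B_{2m-2j+2}+\sum_{j=1}^m\binom{2m+1}{2j}(2n+1)\mathcal{Q}^{\rm Inv}_j(u)B_{2m-2j+1}, \] \[ 4m\,\Sigma^2 n^{2m-1}=\sum_{j=1}^m\binom{2m}{2j-1}n^{2j-1}P^{\rm Inv}_{j-1}(v)B_{2m-2j+1}+\sum_{j=1}^m\binom{2m}{2j}\Bigl((n+2)n^{2j-1}\mathcal{Q}^{\rm Inv}_j(v)+2\,\Sigma n^{2j}\Bigr)B_{2m-2j}, \] \[ (4m+2)\Sigma^2 n^{2m}=\sum_{j=1}^{m+1}\binom{2m+1}{2j-1}\Bigl(n^{2j-1}P^{\rm Inv}_{j-1}(v)+2\,\Sigma n^{2j-1}\Bigr)B_{2m-2j+2}+\sum_{j=1}^m\binom{2m+1}{2j}(n+2)n^{2j-1}\mathcal{Q}^{\rm Inv}_j(v)B_{2m-2j+1}. \]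
   Context: $\Sigma n^m=1^m+\cdots+n^m$ and $\Sigma^2 n^m=\Sigma 1^m+\Sigma 2^m+\cdots+\Sigma n^m$. Bernoulli numbers: $B_0=1$, $B_k=-\frac1{k+1}\sum_{j=0}^{k-1}\binom{k+1}{j}B_j$ ($B_1=-1/2$). For integers $n,k\ge0$: $T_k(n)=\binom{n+k+1}{2k+1}+\binom{n+k}{2k+1}$, $U_k(n)=\binom{n+k}{2k}+\binom{n+k-1}{2k}$ for $k\ge1$ and $U_0(n)=2$. Polynomials: $P_n(x)=\sum_{k=0}^nT_k(n)x^k$, $Q_n(x)=\sum_{k=0}^nU_k(n)x^k$, $\mathcal{P}_n(x)=\sum_{k=0}^n\binom{n+k}{2k}x^k$, $\mathcal{Q}_n(x)=\sum_{k=1}^n\binom{n+k-1}{2k-1}x^k$ for $n\ge1$ (and $\mathcal{Q}_0=1$). For each of these, $F^{\rm Inv}_n(x)=x^nF_n(1/x)$, e.g. $P^{\rm Inv}_n(x)=\sum_{k=0}^nT_k(n)x^{n-k}$. -}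

module Defs where

open import Data.Nat as ℕ using (ℕ; zero; suc; _∸_)
open import Data.Nat.Combinatorics using (_C_)
open import Data.Integer using (+_)
open import Data.Rational using (ℚ; _/_; _+_; _*_; -_; 0ℚ; 1ℚ)
open import Data.List using (List; []; _∷_; _++_; length; zipWith; upTo; sum)
open import Data.List using (foldr)

ι : ℕ → ℚ
ι n = (+ n) / 1

_^ℚ_ : ℚ → ℕ → ℚ
x ^ℚ zero = 1ℚ
x ^ℚ suc k = x * (x ^ℚ k)

-- Σ_{i=a}^{b} f i  (empty sum = 0 when b < a), written  sumFrom a b f
sumFrom : ℕ → ℕ → (ℕ → ℚ) → ℚ
sumFrom a b f = foldr (λ i acc → f (a ℕ.+ i) + acc) 0ℚ (upTo (suc b ∸ a))

-- Bernoulli numbers: B_0 = 1, B_k = -1/(k+1) Σ_{j=0}^{k-1} C(k+1,j) B_j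
-- bernList k = [B_0, …, B_k]

private
  weighted : ℕ → List ℚ → ℚ
  weighted N bs = foldr _+_ 0ℚ (zipWith (λ j b → ι (N C j) * b) (upTo (length bs)) bs)

  lastOr : List ℚ → ℚ
  lastOr [] = 0ℚ
  lastOr (x ∷ []) = x
  lastOr (x ∷ y ∷ xs) = lastOr (y ∷ xs)

bernList : ℕ → List ℚ
bernList zero = 1ℚ ∷ []
bernList (suc k) = bs ++ (- ((+ 1 / suc (suc k)) * weighted (suc (suc k)) bs) ∷ [])
  where bs = bernList k

B : ℕ → ℚ
B k = lastOr (bernList k)

Σpow : ℕ → ℕ → ℚ
Σpow n m = sumFrom 1 n (λ i → ι i ^ℚ m)

Σ²pow : ℕ → ℕ → ℚ
Σ²pow n m = sumFrom 1 n (λ i → Σpow i m)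

T : ℕ → ℕ → ℕ
T k n = ((n ℕ.+ k ℕ.+ 1) C (2 ℕ.* k ℕ.+ 1)) ℕ.+ ((n ℕ.+ k) C (2 ℕ.* k ℕ.+ 1))

U : ℕ → ℕ → ℕ
U zero n = 2
U (suc k) n = ((n ℕ.+ suc k) C (2 ℕ.* suc k)) ℕ.+ ((n ℕ.+ suc k ∸ 1) C (2 ℕ.* suc k))

-- Inverted polynomials  F^Inv_n(x) = x^n F_n(1/x), written out coefficientwise

PInv : ℕ → ℚ → ℚ
PInv n x = sumFrom 0 n (λ k → ι (T k n) * (x ^ℚ (n ∸ k)))

QInv : ℕ → ℚ → ℚ
QInv n x = sumFrom 0 n (λ k → ι (U k n) * (x ^ℚ (n ∸ k)))

cPInv : ℕ → ℚ → ℚ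
cPInv n x = sumFrom 0 n (λ k → ι ((n ℕ.+ k) C (2 ℕ.* k)) * (x ^ℚ (n ∸ k)))

-- calligraphic Q  (𝒬_0 = 1, so 𝒬^Inv_0 = 1)
cQInv : ℕ → ℚ → ℚ
cQInv zero x = 1ℚ
cQInv n@(suc _) x = sumFrom 1 n (λ k → ι ((n ℕ.+ k ∸ 1) C (2 ℕ.* k ∸ 1)) * (x ^ℚ (n ∸ k)))

-- u = n(n+1),  v = (n+1)/n²  (v only used for n ≥ 1; set to 0 at n = 0)

uQ : ℕ → ℚ
uQ n = ι (n ℕ.* (n ℕ.+ 1))

vQ : ℕ → ℚ
vQ zero = 0ℚ
vQ (suc k) = (+ (suc (suc k))) / (suc k ℕ.* suc k)

{-# OPTIONS --safe #-}
-- Write Φ_N(F, G) = Σ_{e=1}^{N} C(N,e) B_{N−e} (F(e) + (−1)^{N−e} G(e)).  The difference equation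
-- B_N(y+1) = B_N(y) + N y^{N−1} of the Bernoulli polynomials gives, by induction on n, the symmetric
-- Faulhaber formula 2N Σn^{N−1} = (B_N(n+1) − B_N) + (−1)^N (B_N(−n) − B_N) = Φ_N((n+1)^•, n^•), and
-- summing it over n gives 2N Σ²n^{N−1} = Φ_N(Σn^• + (n+1)^• − 1, Σn^•).  For N = 2m and N = 2m+1,
-- splitting Φ_N by the parity of e leaves only F(e) ± G(e), which are of the form a^e ± b^e with
-- a = b + 1.  These are the inverted polynomials at x = ab:
--   a^{2j+1} − b^{2j+1} = P^Inv_j(x),            a^{2j} + b^{2j} = Q^Inv_j(x),
--   (a+b) 𝒫^Inv_j(x) = a^{2j+1} + b^{2j+1},      (a+b) 𝒬^Inv_j(x) = a^{2j} − b^{2j},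
-- which follow from the Pascal recurrences of their coefficients.  Taking b = n gives x = u = n(n+1);
-- taking b = 1/n and multiplying by n^e gives x = v = (n+1)/n².

module Submission where

open import Defs
open import Data.Nat as ℕ using (ℕ; zero; suc; _≤_; _∸_; z≤n; s≤s; _!)
open import Data.Nat.Combinatorics using (_C_)
open import Data.Rational using (ℚ; _+_; _*_)
open import Data.Product using (_×_)
open import Relation.Binary.PropositionalEquality using (_≡_)

import Data.Nat.Properties as ℕ
import Data.Nat.DivMod as ℕ
open import Data.Nat.Combinatorics
  using (nCk+nC[k+1]≡[n+1]C[k+1]; nCk≡nC[n∸k]; nCn≡1; nC1≡n; k>n⇒nCk≡0; nCk≡n!/k![n-k]!; k![n∸k]!∣n!)
import Data.Nat.Tactic.RingSolver as ℕ-Solver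
import Data.Integer as ℤ
import Data.Integer.Properties as ℤ
open import Data.Rational using (-_; _-_; 0ℚ; 1ℚ; _/_; 1/_; toℚᵘ; NonZero)
open import Data.Rational.Properties
open import Algebra.Properties.Group +-0-group using () renaming (∙-cancelʳ to +-cancelʳ)
import Data.Rational.Unnormalised as ℚᵘ
import Data.Rational.Unnormalised.Properties as ℚᵘ
open import Data.List using (List; []; _∷_; _++_; applyUpTo; foldr; zipWith; length; upTo)
open import Data.List.Properties using (length-applyUpTo; applyUpTo-∷ʳ)
open import Data.Maybe using (Maybe; just; nothing)
open import Data.Product using (_,_; proj₁; proj₂)
open import Function using (_∘_)
open import Level using (0ℓ)
open import Relation.Binary.PropositionalEquality
open import Relation.Nullary using (yes; no)
import Tactic.RingSolver.Core.AlmostCommutativeRing as ACR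
open import Tactic.RingSolver using (solve-∀)

ℚ-ring : ACR.AlmostCommutativeRing 0ℓ 0ℓ
ℚ-ring = ACR.fromCommutativeRing +-*-commutativeRing isZero
  where
  isZero : ∀ x → Maybe (0ℚ ≡ x)
  isZero x with 0ℚ ≟ x
  ... | yes 0≡x = just 0≡x
  ... | no _ = nothing

ι-suc : ∀ n → ι (suc n) ≡ 1ℚ + ι n
ι-suc n = toℚᵘ-injective (begin
    toℚᵘ (ι (suc n))                ≈⟨ toℚᵘ-fromℚᵘ (ℚᵘ.mkℚᵘ (ℤ.+ suc n) 0) ⟩
    ℚᵘ.mkℚᵘ (ℤ.+ suc n) 0           ≈⟨ ℚᵘ.*≡* cross ⟩
    ℚᵘ.1ℚᵘ ℚᵘ.+ ℚᵘ.mkℚᵘ (ℤ.+ n) 0   ≈⟨ ℚᵘ.+-congʳ ℚᵘ.1ℚᵘ (ℚᵘ.≃-sym (toℚᵘ-fromℚᵘ (ℚᵘ.mkℚᵘ (ℤ.+ n) 0))) ⟩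
    toℚᵘ 1ℚ ℚᵘ.+ toℚᵘ (ι n)         ≈⟨ ℚᵘ.≃-sym (toℚᵘ-homo-+ 1ℚ (ι n)) ⟩
    toℚᵘ (1ℚ + ι n)                 ∎)
  where
  open ℚᵘ.≃-Reasoning
  cross : ℤ.+ suc n ℤ.* ℤ.+ 1 ≡ (ℤ.+ 1 ℤ.* ℤ.+ 1 ℤ.+ ℤ.+ n ℤ.* ℤ.+ 1) ℤ.* ℤ.+ 1
  cross = trans (ℤ.*-identityʳ _) (sym (trans (ℤ.*-identityʳ _) (cong (ℤ._+_ (ℤ.+ 1)) (ℤ.*-identityʳ (ℤ.+ n)))))

ι-suc′ : ∀ n → ι (suc n) ≡ ι n + 1ℚ
ι-suc′ n = trans (ι-suc n) (+-comm 1ℚ (ι n))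

ι-+ : ∀ m n → ι (m ℕ.+ n) ≡ ι m + ι n
ι-+ zero n = sym (+-identityˡ (ι n))
ι-+ (suc m) n = begin
  ι (suc (m ℕ.+ n))   ≡⟨ ι-suc (m ℕ.+ n) ⟩
  1ℚ + ι (m ℕ.+ n)    ≡⟨ cong (1ℚ +_) (ι-+ m n) ⟩
  1ℚ + (ι m + ι n)    ≡⟨ sym (+-assoc 1ℚ (ι m) (ι n)) ⟩
  (1ℚ + ι m) + ι n    ≡⟨ cong (_+ ι n) (sym (ι-suc m)) ⟩
  ι (suc m) + ι n     ∎
  where open ≡-Reasoning

ι[2n]≡ιn+ιn : ∀ n → ι (2 ℕ.* n) ≡ ι n + ι n
ι[2n]≡ιn+ιn n = trans (ι-+ n (n ℕ.+ 0)) (cong (λ k → ι n + ι k) (ℕ.+-identityʳ n))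

ι-* : ∀ m n → ι (m ℕ.* n) ≡ ι m * ι n
ι-* zero n = sym (*-zeroˡ (ι n))
ι-* (suc m) n = begin
  ι (n ℕ.+ m ℕ.* n)    ≡⟨ ι-+ n (m ℕ.* n) ⟩
  ι n + ι (m ℕ.* n)    ≡⟨ cong (ι n +_) (ι-* m n) ⟩
  ι n + ι m * ι n      ≡⟨ cong (_+ ι m * ι n) (sym (*-identityˡ (ι n))) ⟩
  1ℚ * ι n + ι m * ι n ≡⟨ sym (*-distribʳ-+ (ι n) 1ℚ (ι m)) ⟩
  (1ℚ + ι m) * ι n     ≡⟨ cong (_* ι n) (sym (ι-suc m)) ⟩
  ι (suc m) * ι n      ∎
  where open ≡-Reasoning

p/d*d≡p : ∀ p d → ((ℤ.+ p) / suc d) * ι (suc d) ≡ ι p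
p/d*d≡p p d = toℚᵘ-injective (begin
    toℚᵘ ((ℤ.+ p / suc d) * ι (suc d))              ≈⟨ toℚᵘ-homo-* (ℤ.+ p / suc d) (ι (suc d)) ⟩
    toℚᵘ (ℤ.+ p / suc d) ℚᵘ.* toℚᵘ (ι (suc d))      ≈⟨ ℚᵘ.*-cong (toℚᵘ-fromℚᵘ (ℚᵘ.mkℚᵘ (ℤ.+ p) d)) (toℚᵘ-fromℚᵘ (ℚᵘ.mkℚᵘ (ℤ.+ suc d) 0)) ⟩
    ℚᵘ.mkℚᵘ (ℤ.+ p) d ℚᵘ.* ℚᵘ.mkℚᵘ (ℤ.+ suc d) 0   ≈⟨ ℚᵘ.*≡* (ℤ.*-assoc (ℤ.+ p) (ℤ.+ suc d) (ℤ.+ 1)) ⟩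
    ℚᵘ.mkℚᵘ (ℤ.+ p) 0                               ≈⟨ ℚᵘ.≃-sym (toℚᵘ-fromℚᵘ (ℚᵘ.mkℚᵘ (ℤ.+ p) 0)) ⟩
    toℚᵘ (ι p)                                      ∎)
  where open ℚᵘ.≃-Reasoning

^ℚ-distribˡ-+-* : ∀ x m n → x ^ℚ (m ℕ.+ n) ≡ x ^ℚ m * x ^ℚ n
^ℚ-distribˡ-+-* x zero n = sym (*-identityˡ _)
^ℚ-distribˡ-+-* x (suc m) n = trans (cong (x *_) (^ℚ-distribˡ-+-* x m n)) (sym (*-assoc x _ _))

^ℚ-distribʳ-* : ∀ x y n → (x * y) ^ℚ n ≡ x ^ℚ n * y ^ℚ n
^ℚ-distribʳ-* x y zero = refl
^ℚ-distribʳ-* x y (suc n) =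
  trans (cong ((x * y) *_) (^ℚ-distribʳ-* x y n)) (interchange x y (x ^ℚ n) (y ^ℚ n))
  where
  interchange : ∀ (a b c d : ℚ) → (a * b) * (c * d) ≡ (a * c) * (b * d)
  interchange = solve-∀ ℚ-ring

1^ℚ≡1 : ∀ n → 1ℚ ^ℚ n ≡ 1ℚ
1^ℚ≡1 zero = refl
1^ℚ≡1 (suc n) = trans (*-identityˡ _) (1^ℚ≡1 n)

^ℚ-*-assoc : ∀ x m n → (x ^ℚ m) ^ℚ n ≡ x ^ℚ (m ℕ.* n)
^ℚ-*-assoc x m zero = cong (x ^ℚ_) (sym (ℕ.*-zeroʳ m))
^ℚ-*-assoc x m (suc n) = begin
  x ^ℚ m * (x ^ℚ m) ^ℚ n    ≡⟨ cong (x ^ℚ m *_) (^ℚ-*-assoc x m n) ⟩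
  x ^ℚ m * x ^ℚ (m ℕ.* n)   ≡⟨ sym (^ℚ-distribˡ-+-* x m (m ℕ.* n)) ⟩
  x ^ℚ (m ℕ.+ m ℕ.* n)      ≡⟨ cong (x ^ℚ_) (sym (ℕ.*-suc m n)) ⟩
  x ^ℚ (m ℕ.* suc n)        ∎
  where open ≡-Reasoning

-1^_ : ℕ → ℚ
-1^ n = (- 1ℚ) ^ℚ n

-1^n*-1^n≡1 : ∀ n → -1^ n * -1^ n ≡ 1ℚ
-1^n*-1^n≡1 n = trans (sym (^ℚ-distribʳ-* (- 1ℚ) (- 1ℚ) n)) (1^ℚ≡1 n)

-1^[2n]≡1 : ∀ n → -1^ (2 ℕ.* n) ≡ 1ℚ
-1^[2n]≡1 n = trans (sym (^ℚ-*-assoc (- 1ℚ) 2 n)) (1^ℚ≡1 n)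

-1^[1+2n]≡-1 : ∀ n → -1^ suc (2 ℕ.* n) ≡ - 1ℚ
-1^[1+2n]≡-1 n = trans (cong (- 1ℚ *_) (-1^[2n]≡1 n)) (*-identityʳ (- 1ℚ))

-1^[m∸n]≡-1^m*-1^n : ∀ {m n} → n ≤ m → -1^ (m ∸ n) ≡ -1^ m * -1^ n
-1^[m∸n]≡-1^m*-1^n {m} {n} n≤m = begin
  -1^ (m ∸ n)                      ≡⟨ sym (*-identityʳ _) ⟩
  -1^ (m ∸ n) * 1ℚ                 ≡⟨ cong (-1^ (m ∸ n) *_) (sym (-1^n*-1^n≡1 n)) ⟩
  -1^ (m ∸ n) * (-1^ n * -1^ n)    ≡⟨ sym (*-assoc (-1^ (m ∸ n)) _ _) ⟩
  -1^ (m ∸ n) * -1^ n * -1^ n      ≡⟨ cong (_* -1^ n) (sym (^ℚ-distribˡ-+-* (- 1ℚ) (m ∸ n) n)) ⟩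
  -1^ (m ∸ n ℕ.+ n) * -1^ n        ≡⟨ cong (λ k → -1^ k * -1^ n) (ℕ.m∸n+n≡m n≤m) ⟩
  -1^ m * -1^ n                    ∎
  where open ≡-Reasoning

-1^[2m∸k]≡-1^k : ∀ m {k} → k ≤ 2 ℕ.* m → -1^ (2 ℕ.* m ∸ k) ≡ -1^ k
-1^[2m∸k]≡-1^k m k≤2m = trans (-1^[m∸n]≡-1^m*-1^n k≤2m) (trans (cong (_* _) (-1^[2n]≡1 m)) (*-identityˡ _))

-1^[2+2n]≡1 : ∀ n → -1^ suc (suc (2 ℕ.* n)) ≡ 1ℚ
-1^[2+2n]≡1 n = trans (cong -1^_ (sym (ℕ.*-suc 2 n))) (-1^[2n]≡1 (suc n))

-1*x≡-x : ∀ x → - 1ℚ * x ≡ - x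
-1*x≡-x x = trans (sym (neg-distribˡ-* 1ℚ x)) (cong -_ (*-identityˡ x))

neg-^ℚ : ∀ y e → (- y) ^ℚ e ≡ -1^ e * y ^ℚ e
neg-^ℚ y e = trans (cong (_^ℚ e) (sym (-1*x≡-x y))) (^ℚ-distribʳ-* (- 1ℚ) y e)

-- Finite sums

∑ : ℕ → (ℕ → ℚ) → ℚ
∑ zero f = 0ℚ
∑ (suc n) f = f 0 + ∑ n (f ∘ suc)

infixr 10 ∑
syntax ∑ n (λ i → x) = ∑[ i < n ] x

∑-cong-< : ∀ n {f g : ℕ → ℚ} → (∀ i → i ℕ.< n → f i ≡ g i) → ∑ n f ≡ ∑ n g
∑-cong-< zero eq = refl
∑-cong-< (suc n) eq = cong₂ _+_ (eq 0 (s≤s z≤n)) (∑-cong-< n (λ i i<n → eq (suc i) (s≤s i<n)))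

∑-cong : ∀ n {f g : ℕ → ℚ} → (∀ i → f i ≡ g i) → ∑ n f ≡ ∑ n g
∑-cong n eq = ∑-cong-< n (λ i _ → eq i)

∑-zero : ∀ n {f : ℕ → ℚ} → (∀ i → i ℕ.< n → f i ≡ 0ℚ) → ∑ n f ≡ 0ℚ
∑-zero zero eq = refl
∑-zero (suc n) eq = trans (cong₂ _+_ (eq 0 (s≤s z≤n)) (∑-zero n (λ i i<n → eq (suc i) (s≤s i<n)))) (+-identityˡ 0ℚ)

∑-distrib-+ : ∀ n (f g : ℕ → ℚ) → ∑[ i < n ] (f i + g i) ≡ ∑ n f + ∑ n g
∑-distrib-+ zero f g = refl
∑-distrib-+ (suc n) f g =
  trans (cong (f 0 + g 0 +_) (∑-distrib-+ n (f ∘ suc) (g ∘ suc))) (interchange (f 0) (g 0) _ _)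
  where
  interchange : ∀ (a b c d : ℚ) → (a + b) + (c + d) ≡ (a + c) + (b + d)
  interchange = solve-∀ ℚ-ring

∑-distribˡ-* : ∀ n c (f : ℕ → ℚ) → c * ∑ n f ≡ ∑[ i < n ] (c * f i)
∑-distribˡ-* zero c f = *-zeroʳ c
∑-distribˡ-* (suc n) c f = trans (*-distribˡ-+ c (f 0) _) (cong (c * f 0 +_) (∑-distribˡ-* n c (f ∘ suc)))

∑-distribʳ-* : ∀ n c (f : ℕ → ℚ) → ∑ n f * c ≡ ∑[ i < n ] (f i * c)
∑-distribʳ-* n c f = trans (*-comm _ c) (trans (∑-distribˡ-* n c f) (∑-cong n (λ i → *-comm c (f i))))

∑-last : ∀ n (f : ℕ → ℚ) → ∑ (suc n) f ≡ ∑ n f + f n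
∑-last zero f = trans (+-identityʳ (f 0)) (sym (+-identityˡ (f 0)))
∑-last (suc n) f = trans (cong (f 0 +_) (∑-last n (f ∘ suc))) (sym (+-assoc (f 0) _ _))

∑-comm : ∀ m n (f : ℕ → ℕ → ℚ) → ∑[ i < m ] ∑[ j < n ] f i j ≡ ∑[ j < n ] ∑[ i < m ] f i j
∑-comm zero n f = sym (∑-zero n (λ _ _ → refl))
∑-comm (suc m) n f = trans (cong (∑ n (f 0) +_) (∑-comm m n (f ∘ suc))) (sym (∑-distrib-+ n (f 0) _))

∑-reverse : ∀ n (f : ℕ → ℚ) → ∑ n f ≡ ∑[ i < n ] f (n ∸ suc i)
∑-reverse zero f = refl
∑-reverse (suc n) f = trans (∑-last n f) (trans (cong (_+ f n) (∑-reverse n f)) (+-comm _ (f n)))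

∑-triangle : ∀ n (f : ℕ → ℕ → ℚ) → ∑[ k < n ] ∑[ r < n ∸ k ] f k r ≡ ∑[ s < n ] ∑[ k < suc s ] f k (s ∸ k)
∑-triangle zero f = refl
∑-triangle (suc n) f = begin
  ∑[ k < suc n ] ∑ (suc n ∸ k) (f k)
    ≡⟨ ∑-cong-< (suc n) (λ k k≤n → trans (cong (λ l → ∑ l (f k)) (ℕ.+-∸-assoc 1 (ℕ.≤-pred k≤n))) (∑-last (n ∸ k) (f k))) ⟩
  ∑[ k < suc n ] (∑ (n ∸ k) (f k) + f k (n ∸ k))
    ≡⟨ ∑-distrib-+ (suc n) (λ k → ∑ (n ∸ k) (f k)) (λ k → f k (n ∸ k)) ⟩
  ∑[ k < suc n ] ∑ (n ∸ k) (f k) + ∑[ k < suc n ] f k (n ∸ k)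
    ≡⟨ cong (_+ ∑[ k < suc n ] f k (n ∸ k)) lower ⟩
  ∑[ s < n ] ∑[ k < suc s ] f k (s ∸ k) + ∑[ k < suc n ] f k (n ∸ k)
    ≡⟨ sym (∑-last n (λ s → ∑[ k < suc s ] f k (s ∸ k))) ⟩
  ∑[ s < suc n ] ∑[ k < suc s ] f k (s ∸ k) ∎
  where
  open ≡-Reasoning
  lower : ∑[ k < suc n ] ∑ (n ∸ k) (f k) ≡ ∑[ s < n ] ∑[ k < suc s ] f k (s ∸ k)
  lower = begin
    ∑[ k < suc n ] ∑ (n ∸ k) (f k)                ≡⟨ ∑-last n (λ k → ∑ (n ∸ k) (f k)) ⟩
    ∑[ k < n ] ∑ (n ∸ k) (f k) + ∑ (n ∸ n) (f n)  ≡⟨ cong₂ _+_ (∑-triangle n f) (cong (λ l → ∑ l (f n)) (ℕ.n∸n≡0 n)) ⟩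
    ∑[ s < n ] ∑[ k < suc s ] f k (s ∸ k) + 0ℚ    ≡⟨ +-identityʳ _ ⟩
    ∑[ s < n ] ∑[ k < suc s ] f k (s ∸ k)         ∎

∑-split-parity : ∀ m (f : ℕ → ℚ) → ∑ (2 ℕ.* m) f ≡ ∑[ j < m ] f (2 ℕ.* j) + ∑[ j < m ] f (suc (2 ℕ.* j))
∑-split-parity zero f = refl
∑-split-parity (suc m) f = begin
  ∑ (2 ℕ.* suc m) f
    ≡⟨ cong (λ l → ∑ l f) (ℕ.*-suc 2 m) ⟩
  f 0 + (f 1 + ∑ (2 ℕ.* m) (f ∘ suc ∘ suc))
    ≡⟨ cong (λ z → f 0 + (f 1 + z)) (∑-split-parity m (f ∘ suc ∘ suc)) ⟩
  f 0 + (f 1 + (∑[ j < m ] f (2 ℕ.+ 2 ℕ.* j) + ∑[ j < m ] f (3 ℕ.+ 2 ℕ.* j)))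
    ≡⟨ interchange (f 0) (f 1) _ _ ⟩
  (f 0 + ∑[ j < m ] f (2 ℕ.+ 2 ℕ.* j)) + (f 1 + ∑[ j < m ] f (3 ℕ.+ 2 ℕ.* j))
    ≡⟨ cong₂ (λ u v → (f 0 + u) + (f 1 + v)) (∑-cong m (λ j → cong f (sym (ℕ.*-suc 2 j))))
                                               (∑-cong m (λ j → cong (f ∘ suc) (sym (ℕ.*-suc 2 j)))) ⟩
  ∑[ j < suc m ] f (2 ℕ.* j) + ∑[ j < suc m ] f (suc (2 ℕ.* j)) ∎
  where
  open ≡-Reasoning
  interchange : ∀ (a b c d : ℚ) → a + (b + (c + d)) ≡ (a + c) + (b + d)
  interchange = solve-∀ ℚ-ring

∑-split-parity-suc : ∀ m (f : ℕ → ℚ) → ∑ (suc (2 ℕ.* m)) f ≡ ∑[ j < suc m ] f (2 ℕ.* j) + ∑[ j < m ] f (suc (2 ℕ.* j))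
∑-split-parity-suc m f = begin
  ∑ (suc (2 ℕ.* m)) f                                    ≡⟨ ∑-last (2 ℕ.* m) f ⟩
  ∑ (2 ℕ.* m) f + f (2 ℕ.* m)                            ≡⟨ cong (_+ f (2 ℕ.* m)) (∑-split-parity m f) ⟩
  (E + O) + f (2 ℕ.* m)                                  ≡⟨ swap E O (f (2 ℕ.* m)) ⟩
  (E + f (2 ℕ.* m)) + O                                  ≡⟨ cong (_+ O) (sym (∑-last m (λ j → f (2 ℕ.* j)))) ⟩
  ∑[ j < suc m ] f (2 ℕ.* j) + O                         ∎
  where
  open ≡-Reasoning
  E : ℚ
  E = ∑[ j < m ] f (2 ℕ.* j)
  O : ℚ
  O = ∑[ j < m ] f (suc (2 ℕ.* j))
  swap : ∀ (a b c : ℚ) → (a + b) + c ≡ (a + c) + b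
  swap = solve-∀ ℚ-ring

sumFrom≡∑ : ∀ a b f → sumFrom a b f ≡ ∑[ i < suc b ∸ a ] f (a ℕ.+ i)
sumFrom≡∑ a b f = foldr-applyUpTo (suc b ∸ a) (λ i → i)
  where
  foldr-applyUpTo : ∀ n (h : ℕ → ℕ) →
    foldr (λ i acc → f (a ℕ.+ i) + acc) 0ℚ (applyUpTo h n) ≡ ∑[ i < n ] f (a ℕ.+ h i)
  foldr-applyUpTo zero h = refl
  foldr-applyUpTo (suc n) h = cong (f (a ℕ.+ h 0) +_) (foldr-applyUpTo n (h ∘ suc))

sumFrom-cong : ∀ a b {f g : ℕ → ℚ} → (∀ i → f (a ℕ.+ i) ≡ g (a ℕ.+ i)) → sumFrom a b f ≡ sumFrom a b g
sumFrom-cong a b {f} {g} f≗g = trans (sumFrom≡∑ a b f) (trans (∑-cong (suc b ∸ a) f≗g) (sym (sumFrom≡∑ a b g)))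

-- Binomial coefficients

nCk*[k!*[n∸k]!]≡n! : ∀ {n k} → k ≤ n → (n C k) ℕ.* (k ! ℕ.* (n ∸ k) !) ≡ n !
nCk*[k!*[n∸k]!]≡n! {n} {k} k≤n = begin
  (n C k) ℕ.* d                              ≡⟨ cong (ℕ._* d) (nCk≡n!/k![n-k]! k≤n) ⟩
  (n ! ℕ./ d) {{ℕ._!*_!≢0 k (n ∸ k)}} ℕ.* d  ≡⟨ ℕ.m/n*n≡m {{ℕ._!*_!≢0 k (n ∸ k)}} (k![n∸k]!∣n! k≤n) ⟩
  n !                                        ∎
  where
  open ≡-Reasoning
  d : ℕ
  d = k ! ℕ.* (n ∸ k) !

nCk*[n∸k]C[s∸k]≡nCs*sCk : ∀ {n s k} → k ≤ s → s ≤ n → (n C k) ℕ.* ((n ∸ k) C (s ∸ k)) ≡ (n C s) ℕ.* (s C k)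
nCk*[n∸k]C[s∸k]≡nCs*sCk {n} {s} {k} k≤s s≤n = ℕ.*-cancelʳ-≡ _ _ (k ! ℕ.* (r ! ℕ.* t !)) {{nonZero}} (begin
    (n C k) ℕ.* ((n ∸ k) C r) ℕ.* (k ! ℕ.* (r ! ℕ.* t !))
      ≡⟨ regroup (n C k) ((n ∸ k) C r) (k !) (r !) (t !) ⟩
    (n C k) ℕ.* (k ! ℕ.* (((n ∸ k) C r) ℕ.* (r ! ℕ.* t !)))
      ≡⟨ cong (λ z → (n C k) ℕ.* (k ! ℕ.* z)) (trans (cong (λ l → ((n ∸ k) C r) ℕ.* (r ! ℕ.* l !)) (sym n∸k∸r≡t))
                                                        (nCk*[k!*[n∸k]!]≡n! (ℕ.∸-monoˡ-≤ k s≤n))) ⟩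
    (n C k) ℕ.* (k ! ℕ.* (n ∸ k) !)
      ≡⟨ nCk*[k!*[n∸k]!]≡n! (ℕ.≤-trans k≤s s≤n) ⟩
    n !
      ≡⟨ sym (nCk*[k!*[n∸k]!]≡n! s≤n) ⟩
    (n C s) ℕ.* (s ! ℕ.* t !)
      ≡⟨ cong (λ z → (n C s) ℕ.* (z ℕ.* t !)) (sym (nCk*[k!*[n∸k]!]≡n! k≤s)) ⟩
    (n C s) ℕ.* ((s C k) ℕ.* (k ! ℕ.* r !) ℕ.* t !)
      ≡⟨ regroup′ (n C s) (s C k) (k !) (r !) (t !) ⟩
    (n C s) ℕ.* (s C k) ℕ.* (k ! ℕ.* (r ! ℕ.* t !)) ∎)
  where
  open ≡-Reasoning
  r : ℕ
  r = s ∸ k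
  t : ℕ
  t = n ∸ s
  nonZero : ℕ.NonZero (k ! ℕ.* (r ! ℕ.* t !))
  nonZero = ℕ.m*n≢0 (k !) (r ! ℕ.* t !) {{ℕ._!≢0 k}} {{ℕ._!*_!≢0 r t}}
  n∸k∸r≡t : n ∸ k ∸ r ≡ t
  n∸k∸r≡t = trans (ℕ.∸-+-assoc n k r) (cong (n ∸_) (ℕ.m+[n∸m]≡n k≤s))
  regroup : ∀ a b x y z → a ℕ.* b ℕ.* (x ℕ.* (y ℕ.* z)) ≡ a ℕ.* (x ℕ.* (b ℕ.* (y ℕ.* z)))
  regroup = ℕ-Solver.solve-∀
  regroup′ : ∀ a b x y z → a ℕ.* (b ℕ.* (x ℕ.* y) ℕ.* z) ≡ a ℕ.* b ℕ.* (x ℕ.* (y ℕ.* z))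
  regroup′ = ℕ-Solver.solve-∀

binomial : ∀ x m → (x + 1ℚ) ^ℚ m ≡ ∑[ r < suc m ] (ι (m C r) * x ^ℚ (m ∸ r))
binomial x zero = refl
binomial x (suc m) = begin
  (x + 1ℚ) * (x + 1ℚ) ^ℚ m          ≡⟨ cong ((x + 1ℚ) *_) (binomial x m) ⟩
  (x + 1ℚ) * A                      ≡⟨ *-distribʳ-+ A x 1ℚ ⟩
  x * A + 1ℚ * A                    ≡⟨ cong₂ _+_ x*A (*-identityˡ A) ⟩
  (x ^ℚ suc m + ∑ m g) + A          ≡⟨ +-assoc (x ^ℚ suc m) (∑ m g) A ⟩
  x ^ℚ suc m + (∑ m g + A)          ≡⟨ cong (x ^ℚ suc m +_) (+-comm (∑ m g) A) ⟩
  x ^ℚ suc m + (A + ∑ m g)          ≡⟨ cong (λ z → x ^ℚ suc m + (A + z)) (sym drop-last) ⟩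
  x ^ℚ suc m + (A + ∑ (suc m) g)    ≡⟨ cong₂ _+_ (sym (*-identityˡ (x ^ℚ suc m))) (sym pascal) ⟩
  ∑[ r < suc (suc m) ] (ι (suc m C r) * x ^ℚ (suc m ∸ r)) ∎
  where
  open ≡-Reasoning
  f g : ℕ → ℚ
  f r = ι (m C r) * x ^ℚ (m ∸ r)
  g r = ι (m C suc r) * x ^ℚ (m ∸ r)
  A : ℚ
  A = ∑ (suc m) f
  pascal : ∑[ r < suc m ] (ι (suc m C suc r) * x ^ℚ (m ∸ r)) ≡ A + ∑ (suc m) g
  pascal = trans (∑-cong (suc m) λ r → begin
      ι (suc m C suc r) * x ^ℚ (m ∸ r)                   ≡⟨ cong (λ c → ι c * x ^ℚ (m ∸ r)) (sym (nCk+nC[k+1]≡[n+1]C[k+1] m r)) ⟩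
      ι (m C r ℕ.+ m C suc r) * x ^ℚ (m ∸ r)             ≡⟨ cong (_* x ^ℚ (m ∸ r)) (ι-+ (m C r) (m C suc r)) ⟩
      (ι (m C r) + ι (m C suc r)) * x ^ℚ (m ∸ r)         ≡⟨ *-distribʳ-+ (x ^ℚ (m ∸ r)) (ι (m C r)) (ι (m C suc r)) ⟩
      f r + g r                                          ∎)
    (∑-distrib-+ (suc m) f g)
  drop-last : ∑ (suc m) g ≡ ∑ m g
  drop-last = begin
    ∑ (suc m) g       ≡⟨ ∑-last m g ⟩
    ∑ m g + g m       ≡⟨ cong (λ c → ∑ m g + ι c * x ^ℚ (m ∸ m)) (k>n⇒nCk≡0 (ℕ.n<1+n m)) ⟩
    ∑ m g + 0ℚ * x ^ℚ (m ∸ m) ≡⟨ cong (∑ m g +_) (*-zeroˡ (x ^ℚ (m ∸ m))) ⟩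
    ∑ m g + 0ℚ        ≡⟨ +-identityʳ (∑ m g) ⟩
    ∑ m g             ∎
  x*A : x * A ≡ x ^ℚ suc m + ∑ m g
  x*A = begin
    x * (ι 1 * x ^ℚ m + ∑ m (f ∘ suc))     ≡⟨ *-distribˡ-+ x _ _ ⟩
    x * (ι 1 * x ^ℚ m) + x * ∑ m (f ∘ suc) ≡⟨ cong₂ _+_ (cong (x *_) (*-identityˡ (x ^ℚ m))) (∑-distribˡ-* m x (f ∘ suc)) ⟩
    x ^ℚ suc m + ∑[ r < m ] (x * f (suc r)) ≡⟨ cong (x ^ℚ suc m +_) (∑-cong-< m (λ r r<m → shift r r<m)) ⟩
    x ^ℚ suc m + ∑ m g                     ∎
    where
    shift : ∀ r → r ℕ.< m → x * f (suc r) ≡ g r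
    shift r r<m = begin
      x * (ι (m C suc r) * x ^ℚ (m ∸ suc r))   ≡⟨ x*[y*z]≡y*[x*z] x (ι (m C suc r)) _ ⟩
      ι (m C suc r) * x ^ℚ suc (m ∸ suc r)     ≡⟨ cong (λ e → ι (m C suc r) * x ^ℚ e) (sym (ℕ.+-∸-assoc 1 r<m)) ⟩
      g r                                      ∎
      where
      x*[y*z]≡y*[x*z] : ∀ (a b c : ℚ) → a * (b * c) ≡ b * (a * c)
      x*[y*z]≡y*[x*z] = solve-∀ ℚ-ring

∑-binomial-shift : ∀ N (c : ℕ → ℚ) x →
  ∑[ k < suc N ] (ι (N C k) * c k * (x + 1ℚ) ^ℚ (N ∸ k))
    ≡ ∑[ s < suc N ] (ι (N C s) * x ^ℚ (N ∸ s) * ∑[ k < suc s ] (ι (s C k) * c k))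
∑-binomial-shift N c x = begin
  ∑[ k < suc N ] (ι (N C k) * c k * (x + 1ℚ) ^ℚ (N ∸ k))
    ≡⟨ ∑-cong-< (suc N) (λ k k≤N → expand k (ℕ.≤-pred k≤N)) ⟩
  ∑[ k < suc N ] ∑ (suc N ∸ k) (h k)
    ≡⟨ ∑-triangle (suc N) h ⟩
  ∑[ s < suc N ] ∑[ k < suc s ] h k (s ∸ k)
    ≡⟨ ∑-cong-< (suc N) (λ s s≤N → revise s (ℕ.≤-pred s≤N)) ⟩
  ∑[ s < suc N ] (t s * ∑[ k < suc s ] (ι (s C k) * c k)) ∎
  where
  open ≡-Reasoning
  h : ℕ → ℕ → ℚ
  h k r = ι (N C k) * c k * (ι ((N ∸ k) C r) * x ^ℚ (N ∸ k ∸ r))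
  t : ℕ → ℚ
  t s = ι (N C s) * x ^ℚ (N ∸ s)
  expand : ∀ k → k ≤ N → ι (N C k) * c k * (x + 1ℚ) ^ℚ (N ∸ k) ≡ ∑ (suc N ∸ k) (h k)
  expand k k≤N = begin
    ι (N C k) * c k * (x + 1ℚ) ^ℚ (N ∸ k)
      ≡⟨ cong (ι (N C k) * c k *_) (binomial x (N ∸ k)) ⟩
    ι (N C k) * c k * ∑[ r < suc (N ∸ k) ] (ι ((N ∸ k) C r) * x ^ℚ (N ∸ k ∸ r))
      ≡⟨ ∑-distribˡ-* (suc (N ∸ k)) (ι (N C k) * c k) (λ r → ι ((N ∸ k) C r) * x ^ℚ (N ∸ k ∸ r)) ⟩
    ∑ (suc (N ∸ k)) (h k)
      ≡⟨ cong (λ l → ∑ l (h k)) (sym (ℕ.+-∸-assoc 1 k≤N)) ⟩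
    ∑ (suc N ∸ k) (h k) ∎
  revise : ∀ s → s ≤ N → ∑[ k < suc s ] h k (s ∸ k) ≡ t s * ∑[ k < suc s ] (ι (s C k) * c k)
  revise s s≤N = trans (∑-cong-< (suc s) (λ k k≤s → term (ℕ.≤-pred k≤s))) (sym (∑-distribˡ-* (suc s) (t s) (λ k → ι (s C k) * c k)))
    where
    term : ∀ {k} → k ≤ s → h k (s ∸ k) ≡ t s * (ι (s C k) * c k)
    term {k} k≤s = begin
      ι (N C k) * c k * (ι ((N ∸ k) C (s ∸ k)) * x ^ℚ (N ∸ k ∸ (s ∸ k)))
        ≡⟨ cong (λ e → ι (N C k) * c k * (ι ((N ∸ k) C (s ∸ k)) * x ^ℚ e)) exponent ⟩
      ι (N C k) * c k * (ι ((N ∸ k) C (s ∸ k)) * x ^ℚ (N ∸ s))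
        ≡⟨ regroup (ι (N C k)) (c k) (ι ((N ∸ k) C (s ∸ k))) (x ^ℚ (N ∸ s)) ⟩
      ι (N C k) * ι ((N ∸ k) C (s ∸ k)) * (x ^ℚ (N ∸ s) * c k)
        ≡⟨ cong (_* (x ^ℚ (N ∸ s) * c k)) (sym (ι-* (N C k) ((N ∸ k) C (s ∸ k)))) ⟩
      ι ((N C k) ℕ.* ((N ∸ k) C (s ∸ k))) * (x ^ℚ (N ∸ s) * c k)
        ≡⟨ cong (λ z → ι z * (x ^ℚ (N ∸ s) * c k)) (nCk*[n∸k]C[s∸k]≡nCs*sCk k≤s s≤N) ⟩
      ι ((N C s) ℕ.* (s C k)) * (x ^ℚ (N ∸ s) * c k)
        ≡⟨ cong (_* (x ^ℚ (N ∸ s) * c k)) (ι-* (N C s) (s C k)) ⟩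
      ι (N C s) * ι (s C k) * (x ^ℚ (N ∸ s) * c k)
        ≡⟨ regroup′ (ι (N C s)) (ι (s C k)) (x ^ℚ (N ∸ s)) (c k) ⟩
      t s * (ι (s C k) * c k) ∎
      where
      exponent : N ∸ k ∸ (s ∸ k) ≡ N ∸ s
      exponent = trans (ℕ.∸-+-assoc N k (s ∸ k)) (cong (N ∸_) (ℕ.m+[n∸m]≡n k≤s))
      regroup : ∀ (a b c d : ℚ) → a * b * (c * d) ≡ a * c * (d * b)
      regroup = solve-∀ ℚ-ring
      regroup′ : ∀ (a b c d : ℚ) → a * b * (c * d) ≡ a * c * (b * d)
      regroup′ = solve-∀ ℚ-ring

[n+1]Cn≡n+1 : ∀ n → suc n C n ≡ suc n
[n+1]Cn≡n+1 n = begin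
  suc n C n             ≡⟨ nCk≡nC[n∸k] (ℕ.n≤1+n n) ⟩
  suc n C (suc n ∸ n)   ≡⟨ cong (suc n C_) (ℕ.m+n∸n≡m 1 n) ⟩
  suc n C 1             ≡⟨ nC1≡n (suc n) ⟩
  suc n                 ∎
  where open ≡-Reasoning

-- Bernoulli numbers and polynomials

-- `lastOr` is private to Defs: `lastOr′` is a meta that the with-abstraction in `B≡lastOr′` solves to it.
private
  mutual
    lastOr′ : List ℚ → ℚ
    lastOr′ = _

    B≡lastOr′ : ∀ k → B k ≡ lastOr′ (bernList k)
    B≡lastOr′ k with bernList k
    ... | bs = refl

  lastOr′-snoc : ∀ xs y → lastOr′ (xs ++ y ∷ []) ≡ y
  lastOr′-snoc [] y = refl
  lastOr′-snoc (x ∷ []) y = refl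
  lastOr′-snoc (x ∷ x′ ∷ xs) y = lastOr′-snoc (x′ ∷ xs) y

bernList≡applyUpTo : ∀ k → bernList k ≡ applyUpTo B (suc k)
bernList≡applyUpTo zero = refl
bernList≡applyUpTo (suc k) = begin
  bernList (suc k)                       ≡⟨ cong (λ b → bernList k ++ b ∷ []) (sym (trans (B≡lastOr′ (suc k)) (lastOr′-snoc (bernList k) _))) ⟩
  bernList k ++ B (suc k) ∷ []           ≡⟨ cong (_++ B (suc k) ∷ []) (bernList≡applyUpTo k) ⟩
  applyUpTo B (suc k) ++ B (suc k) ∷ []  ≡⟨ applyUpTo-∷ʳ B (suc k) ⟩
  applyUpTo B (suc (suc k))              ∎
  where open ≡-Reasoning

B-suc : ∀ k → B (suc k) ≡ - ((ℤ.+ 1 / suc (suc k)) * ∑[ j < suc k ] (ι (suc (suc k) C j) * B j))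
B-suc k = trans (B≡lastOr′ (suc k)) (trans (lastOr′-snoc (bernList k) _) (cong (λ w → - ((ℤ.+ 1 / N) * w)) weighted≡∑))
  where
  open ≡-Reasoning
  N : ℕ
  N = suc (suc k)
  c : ℕ → ℚ → ℚ
  c j b = ι (N C j) * b
  zipWith-applyUpTo : ∀ n (g : ℕ → ℕ) (h : ℕ → ℚ) →
    zipWith c (applyUpTo g n) (applyUpTo h n) ≡ applyUpTo (λ i → c (g i) (h i)) n
  zipWith-applyUpTo zero g h = refl
  zipWith-applyUpTo (suc n) g h = cong (c (g 0) (h 0) ∷_) (zipWith-applyUpTo n (g ∘ suc) (h ∘ suc))
  foldr-applyUpTo : ∀ n (f : ℕ → ℚ) → foldr _+_ 0ℚ (applyUpTo f n) ≡ ∑ n f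
  foldr-applyUpTo zero f = refl
  foldr-applyUpTo (suc n) f = cong (f 0 +_) (foldr-applyUpTo n (f ∘ suc))
  weighted≡∑ : foldr _+_ 0ℚ (zipWith c (upTo (length (bernList k))) (bernList k)) ≡ ∑[ j < suc k ] c j (B j)
  weighted≡∑ = begin
    foldr _+_ 0ℚ (zipWith c (upTo (length (bernList k))) (bernList k))
      ≡⟨ cong (λ bs → foldr _+_ 0ℚ (zipWith c (upTo (length bs)) bs)) (bernList≡applyUpTo k) ⟩
    foldr _+_ 0ℚ (zipWith c (upTo (length (applyUpTo B (suc k)))) (applyUpTo B (suc k)))
      ≡⟨ cong (λ l → foldr _+_ 0ℚ (zipWith c (upTo l) (applyUpTo B (suc k)))) (length-applyUpTo B (suc k)) ⟩
    foldr _+_ 0ℚ (zipWith c (upTo (suc k)) (applyUpTo B (suc k)))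
      ≡⟨ cong (foldr _+_ 0ℚ) (zipWith-applyUpTo (suc k) (λ i → i) B) ⟩
    foldr _+_ 0ℚ (applyUpTo (λ j → c j (B j)) (suc k))
      ≡⟨ foldr-applyUpTo (suc k) (λ j → c j (B j)) ⟩
    ∑[ j < suc k ] c j (B j) ∎

bernoulli-recurrence : ∀ k → ∑[ j < suc (suc k) ] (ι (suc (suc k) C j) * B j) ≡ 0ℚ
bernoulli-recurrence k = begin
  ∑ (suc N′) f                       ≡⟨ ∑-last N′ f ⟩
  W + ι (N C N′) * B N′              ≡⟨ cong₂ (λ c b → W + ι c * b) ([n+1]Cn≡n+1 N′) (B-suc k) ⟩
  W + ι N * (- ((ℤ.+ 1 / N) * W))    ≡⟨ rearrange W (ι N) (ℤ.+ 1 / N) ⟩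
  W - ((ℤ.+ 1 / N) * ι N) * W        ≡⟨ cong (λ z → W - z * W) (p/d*d≡p 1 N′) ⟩
  W - 1ℚ * W                         ≡⟨ cancel W ⟩
  0ℚ                                 ∎
  where
  open ≡-Reasoning
  N′ : ℕ
  N′ = suc k
  N : ℕ
  N = suc N′
  f : ℕ → ℚ
  f j = ι (N C j) * B j
  W : ℚ
  W = ∑ N′ f
  rearrange : ∀ (w n i : ℚ) → w + n * (- (i * w)) ≡ w - (i * n) * w
  rearrange = solve-∀ ℚ-ring
  cancel : ∀ (w : ℚ) → w - 1ℚ * w ≡ 0ℚ
  cancel = solve-∀ ℚ-ring

δ₁ : ℕ → ℚ
δ₁ 1 = 1ℚ
δ₁ _ = 0ℚ

∑-binomial-B : ∀ s → ∑[ k < suc s ] (ι (s C k) * B k) ≡ B s + δ₁ s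
∑-binomial-B zero = refl
∑-binomial-B (suc zero) = refl
∑-binomial-B (suc (suc s)) = begin
  ∑ (suc N) f                ≡⟨ ∑-last N f ⟩
  ∑ N f + ι (N C N) * B N    ≡⟨ cong₂ (λ z c → z + ι c * B N) (bernoulli-recurrence s) (nCn≡1 N) ⟩
  0ℚ + 1ℚ * B N              ≡⟨ simplify (B N) ⟩
  B N + 0ℚ                   ∎
  where
  open ≡-Reasoning
  N : ℕ
  N = suc (suc s)
  f : ℕ → ℚ
  f k = ι (N C k) * B k
  simplify : ∀ b → 0ℚ + 1ℚ * b ≡ b + 0ℚ
  simplify = solve-∀ ℚ-ring

bernoulliPoly : ℕ → ℚ → ℚ
bernoulliPoly N x = ∑[ k < suc N ] (ι (N C k) * B k * x ^ℚ (N ∸ k))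

∑-*-δ₁ : ∀ n (f : ℕ → ℚ) → ∑[ s < suc (suc n) ] (f s * δ₁ s) ≡ f 1
∑-*-δ₁ n f = begin
  f 0 * 0ℚ + (f 1 * 1ℚ + ∑[ s < n ] (f (suc (suc s)) * 0ℚ))
    ≡⟨ cong (λ z → f 0 * 0ℚ + (f 1 * 1ℚ + z)) (∑-zero n (λ s _ → *-zeroʳ (f (suc (suc s))))) ⟩
  f 0 * 0ℚ + (f 1 * 1ℚ + 0ℚ)
    ≡⟨ simplify (f 0) (f 1) ⟩
  f 1 ∎
  where
  open ≡-Reasoning
  simplify : ∀ (a b : ℚ) → a * 0ℚ + (b * 1ℚ + 0ℚ) ≡ b
  simplify = solve-∀ ℚ-ring

bernoulliPoly-step : ∀ p x → bernoulliPoly (suc p) (x + 1ℚ) ≡ bernoulliPoly (suc p) x + ι (suc p) * x ^ℚ p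
bernoulliPoly-step p x = begin
  bernoulliPoly N (x + 1ℚ)
    ≡⟨ ∑-binomial-shift N B x ⟩
  ∑[ s < suc N ] (t s * ∑[ k < suc s ] (ι (s C k) * B k))
    ≡⟨ ∑-cong (suc N) (λ s → trans (cong (t s *_) (∑-binomial-B s)) (*-distribˡ-+ (t s) (B s) (δ₁ s))) ⟩
  ∑[ s < suc N ] (t s * B s + t s * δ₁ s)
    ≡⟨ ∑-distrib-+ (suc N) (λ s → t s * B s) (λ s → t s * δ₁ s) ⟩
  ∑[ s < suc N ] (t s * B s) + ∑[ s < suc N ] (t s * δ₁ s)
    ≡⟨ cong₂ _+_ (∑-cong (suc N) (λ s → swap (ι (N C s)) (x ^ℚ (N ∸ s)) (B s))) (∑-*-δ₁ p t) ⟩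
  bernoulliPoly N x + ι (N C 1) * x ^ℚ p
    ≡⟨ cong (λ z → bernoulliPoly N x + ι z * x ^ℚ p) (nC1≡n N) ⟩
  bernoulliPoly N x + ι N * x ^ℚ p ∎
  where
  open ≡-Reasoning
  N : ℕ
  N = suc p
  t : ℕ → ℚ
  t s = ι (N C s) * x ^ℚ (N ∸ s)
  swap : ∀ (a b c : ℚ) → a * b * c ≡ a * c * b
  swap = solve-∀ ℚ-ring

-- β N y = B_N(y) − B_N, summed over the exponent i + 1 of y.
β : ℕ → ℚ → ℚ
β N y = ∑[ i < N ] (ι (N C suc i) * B (N ∸ suc i) * y ^ℚ suc i)

bernoulliPoly≡β+B : ∀ N y → bernoulliPoly N y ≡ β N y + B N
bernoulliPoly≡β+B N y = begin
  bernoulliPoly N y                  ≡⟨ ∑-reverse (suc N) f ⟩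
  f (N ∸ 0) + ∑[ i < N ] f (N ∸ suc i) ≡⟨ cong₂ _+_ top (∑-cong-< N (λ i i<N → reflect i<N)) ⟩
  B N + β N y                        ≡⟨ +-comm (B N) (β N y) ⟩
  β N y + B N                        ∎
  where
  open ≡-Reasoning
  f : ℕ → ℚ
  f k = ι (N C k) * B k * y ^ℚ (N ∸ k)
  top : f N ≡ B N
  top = begin
    ι (N C N) * B N * y ^ℚ (N ∸ N)  ≡⟨ cong₂ (λ c e → ι c * B N * y ^ℚ e) (nCn≡1 N) (ℕ.n∸n≡0 N) ⟩
    1ℚ * B N * 1ℚ                   ≡⟨ *-identityʳ (1ℚ * B N) ⟩
    1ℚ * B N                        ≡⟨ *-identityˡ (B N) ⟩
    B N                             ∎
  reflect : ∀ {i} → i ℕ.< N → f (N ∸ suc i) ≡ ι (N C suc i) * B (N ∸ suc i) * y ^ℚ suc i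
  reflect {i} i<N = cong₂ (λ c e → ι c * B (N ∸ suc i) * y ^ℚ e) (sym (nCk≡nC[n∸k] i<N)) (ℕ.m∸[m∸n]≡n i<N)

β-step : ∀ p y → β (suc p) (y + 1ℚ) ≡ β (suc p) y + ι (suc p) * y ^ℚ p
β-step p y = +-cancelʳ (B N) _ _ (begin
  β N (y + 1ℚ) + B N                    ≡⟨ sym (bernoulliPoly≡β+B N (y + 1ℚ)) ⟩
  bernoulliPoly N (y + 1ℚ)              ≡⟨ bernoulliPoly-step p y ⟩
  bernoulliPoly N y + ι N * y ^ℚ p      ≡⟨ cong (_+ ι N * y ^ℚ p) (bernoulliPoly≡β+B N y) ⟩
  β N y + B N + ι N * y ^ℚ p            ≡⟨ swap (β N y) (B N) (ι N * y ^ℚ p) ⟩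
  β N y + ι N * y ^ℚ p + B N            ∎)
  where
  open ≡-Reasoning
  N : ℕ
  N = suc p
  swap : ∀ (a b c : ℚ) → a + b + c ≡ a + c + b
  swap = solve-∀ ℚ-ring

β-zero : ∀ N → β N 0ℚ ≡ 0ℚ
β-zero N = ∑-zero N (λ i _ → trans (cong (c i *_) (*-zeroˡ (0ℚ ^ℚ i))) (*-zeroʳ (c i)))
  where
  c : ℕ → ℚ
  c i = ι (N C suc i) * B (N ∸ suc i)

β-one : ∀ q → β (suc (suc q)) 1ℚ ≡ 0ℚ
β-one q = +-cancelʳ (B N) _ _ (begin
  β N 1ℚ + B N                                   ≡⟨ sym (bernoulliPoly≡β+B N 1ℚ) ⟩
  ∑[ k < suc N ] (ι (N C k) * B k * 1ℚ ^ℚ (N ∸ k)) ≡⟨ ∑-cong (suc N) (λ k → trans (cong (ι (N C k) * B k *_) (1^ℚ≡1 (N ∸ k))) (*-identityʳ (ι (N C k) * B k))) ⟩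
  ∑[ k < suc N ] (ι (N C k) * B k)                 ≡⟨ ∑-binomial-B N ⟩
  B N + 0ℚ                                       ≡⟨ +-comm (B N) 0ℚ ⟩
  0ℚ + B N                                       ∎)
  where
  open ≡-Reasoning
  N : ℕ
  N = suc (suc q)

-- The symmetric Faulhaber formula

Σpow-suc : ∀ n e → Σpow (suc n) e ≡ Σpow n e + ι (suc n) ^ℚ e
Σpow-suc n e = begin
  Σpow (suc n) e                        ≡⟨ sumFrom≡∑ 1 (suc n) (λ i → ι i ^ℚ e) ⟩
  ∑[ i < suc n ] (ι (suc i) ^ℚ e)        ≡⟨ ∑-last n (λ i → ι (suc i) ^ℚ e) ⟩
  ∑[ i < n ] (ι (suc i) ^ℚ e) + ι (suc n) ^ℚ e ≡⟨ cong (_+ ι (suc n) ^ℚ e) (sym (sumFrom≡∑ 1 n (λ i → ι i ^ℚ e))) ⟩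
  Σpow n e + ι (suc n) ^ℚ e              ∎
  where open ≡-Reasoning

Σpow-symmetric : ∀ q n → let N = suc (suc q) in
  ι (2 ℕ.* N) * Σpow n (suc q) ≡ β N (ι (suc n)) + -1^ N * β N (- ι n)
Σpow-symmetric q zero = sym (begin
  β N 1ℚ + -1^ N * β N 0ℚ  ≡⟨ cong₂ (λ u v → u + -1^ N * v) (β-one q) (β-zero N) ⟩
  0ℚ + -1^ N * 0ℚ          ≡⟨ trans (+-identityˡ _) (*-zeroʳ (-1^ N)) ⟩
  0ℚ                       ≡⟨ sym (*-zeroʳ (ι (2 ℕ.* N))) ⟩
  ι (2 ℕ.* N) * 0ℚ         ∎)
  where
  open ≡-Reasoning
  N : ℕ
  N = suc (suc q)
Σpow-symmetric q (suc n) = begin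
  ι (2 ℕ.* N) * Σpow (suc n) p                         ≡⟨ cong₂ _*_ (ι[2n]≡ιn+ιn N) (Σpow-suc n p) ⟩
  (ι N + ι N) * (Σpow n p + y ^ℚ p)                   ≡⟨ *-distribˡ-+ (ι N + ι N) (Σpow n p) (y ^ℚ p) ⟩
  (ι N + ι N) * Σpow n p + (ι N + ι N) * y ^ℚ p       ≡⟨ cong (_+ (ι N + ι N) * y ^ℚ p) (trans (cong (_* Σpow n p) (sym (ι[2n]≡ιn+ιn N))) ih) ⟩
  (β N y + -1^ N * (β N (- y) + ι N * (-1^ p * y ^ℚ p))) + (ι N + ι N) * y ^ℚ p
                                                       ≡⟨ collapse (ι N) (y ^ℚ p) (β N y) (β N (- y)) (-1^ N) (-1^ p) -1^N*-1^p ⟩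
  (β N y + ι N * y ^ℚ p) + -1^ N * β N (- y)          ≡⟨ cong (_+ -1^ N * β N (- y)) (sym (trans (cong (β N) (ι-suc′ (suc n))) (β-step p y))) ⟩
  β N (ι (suc (suc n))) + -1^ N * β N (- y)           ∎
  where
  open ≡-Reasoning
  N : ℕ
  N = suc (suc q)
  p : ℕ
  p = suc q
  y : ℚ
  y = ι (suc n)
  -- This sign makes the differences of β at n + 1 and at −n add up instead of cancelling.
  -1^N*-1^p : -1^ N * -1^ p ≡ - 1ℚ
  -1^N*-1^p = trans (*-assoc (- 1ℚ) (-1^ p) (-1^ p)) (trans (cong (- 1ℚ *_) (-1^n*-1^n≡1 p)) (*-identityʳ (- 1ℚ)))
  negate : ∀ a → - a ≡ - (a + 1ℚ) + 1ℚ
  negate = solve-∀ ℚ-ring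
  ih : ι (2 ℕ.* N) * Σpow n p ≡ β N y + -1^ N * (β N (- y) + ι N * (-1^ p * y ^ℚ p))
  ih = trans (Σpow-symmetric q n) (cong (λ z → β N y + -1^ N * z) (begin
    β N (- ι n)                        ≡⟨ cong (β N) (trans (negate (ι n)) (cong (λ z → - z + 1ℚ) (sym (ι-suc′ n)))) ⟩
    β N (- y + 1ℚ)                     ≡⟨ β-step p (- y) ⟩
    β N (- y) + ι N * (- y) ^ℚ p       ≡⟨ cong (λ z → β N (- y) + ι N * z) (neg-^ℚ y p) ⟩
    β N (- y) + ι N * (-1^ p * y ^ℚ p) ∎))
  collapse : ∀ (n Y b₁ b₂ σ σ′ : ℚ) → σ * σ′ ≡ - 1ℚ →
             (b₁ + σ * (b₂ + n * (σ′ * Y))) + (n + n) * Y ≡ (b₁ + n * Y) + σ * b₂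
  collapse n Y b₁ b₂ σ σ′ σσ′≡-1 = begin
    (b₁ + σ * (b₂ + n * (σ′ * Y))) + (n + n) * Y     ≡⟨ expand n Y b₁ b₂ σ σ′ ⟩
    (b₁ + σ * b₂) + ((σ * σ′) * (n * Y) + (n + n) * Y) ≡⟨ cong (λ z → (b₁ + σ * b₂) + (z * (n * Y) + (n + n) * Y)) σσ′≡-1 ⟩
    (b₁ + σ * b₂) + (- 1ℚ * (n * Y) + (n + n) * Y)   ≡⟨ simplify n Y b₁ b₂ σ ⟩
    (b₁ + n * Y) + σ * b₂                            ∎
    where
    expand : ∀ (n Y b₁ b₂ σ σ′ : ℚ) → (b₁ + σ * (b₂ + n * (σ′ * Y))) + (n + n) * Y ≡ (b₁ + σ * b₂) + ((σ * σ′) * (n * Y) + (n + n) * Y)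
    expand = solve-∀ ℚ-ring
    simplify : ∀ (n Y b₁ b₂ σ : ℚ) → (b₁ + σ * b₂) + (- 1ℚ * (n * Y) + (n + n) * Y) ≡ (b₁ + n * Y) + σ * b₂
    simplify = solve-∀ ℚ-ring

Φ-term : ℕ → (ℕ → ℚ) → (ℕ → ℚ) → ℕ → ℚ
Φ-term N F G e = ι (N C e) * (F e + -1^ (N ∸ e) * G e) * B (N ∸ e)

Φ : ℕ → (ℕ → ℚ) → (ℕ → ℚ) → ℚ
Φ N F G = ∑[ i < N ] Φ-term N F G (suc i)

Φ-cong : ∀ N {F F′ G G′ : ℕ → ℚ} → (∀ e → F e ≡ F′ e) → (∀ e → G e ≡ G′ e) → Φ N F G ≡ Φ N F′ G′
Φ-cong N F≗F′ G≗G′ = ∑-cong N (λ i →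
  cong₂ (λ u v → ι (N C suc i) * (u + -1^ (N ∸ suc i) * v) * B (N ∸ suc i)) (F≗F′ (suc i)) (G≗G′ (suc i)))

∑-Φ : ∀ n N (F G : ℕ → ℕ → ℚ) →
  ∑[ j < n ] Φ N (F j) (G j) ≡ Φ N (λ e → ∑[ j < n ] F j e) (λ e → ∑[ j < n ] G j e)
∑-Φ n N F G = trans (∑-comm n N _) (∑-cong N term)
  where
  open ≡-Reasoning
  term : ∀ i → let e = suc i; c = ι (N C e); s = -1^ (N ∸ e); b = B (N ∸ e) in
    ∑[ j < n ] (c * (F j e + s * G j e) * b) ≡ c * (∑[ j < n ] F j e + s * ∑[ j < n ] G j e) * b
  term i = begin
    ∑[ j < n ] (c * (F j e + s * G j e) * b)         ≡⟨ sym (∑-distribʳ-* n b (λ j → c * (F j e + s * G j e))) ⟩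
    ∑[ j < n ] (c * (F j e + s * G j e)) * b         ≡⟨ cong (_* b) (sym (∑-distribˡ-* n c (λ j → F j e + s * G j e))) ⟩
    c * ∑[ j < n ] (F j e + s * G j e) * b           ≡⟨ cong (λ z → c * z * b) (∑-distrib-+ n (λ j → F j e) (λ j → s * G j e)) ⟩
    c * (∑[ j < n ] F j e + ∑[ j < n ] (s * G j e)) * b ≡⟨ cong (λ z → c * (∑[ j < n ] F j e + z) * b) (sym (∑-distribˡ-* n s (λ j → G j e))) ⟩
    c * (∑[ j < n ] F j e + s * ∑[ j < n ] G j e) * b ∎
    where
    e : ℕ
    e = suc i
    c : ℚ
    c = ι (N C e)
    s : ℚ
    s = -1^ (N ∸ e)
    b : ℚ
    b = B (N ∸ e)

β-reflect : ∀ N Y y → β N Y + -1^ N * β N (- y) ≡ Φ N (Y ^ℚ_) (y ^ℚ_)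
β-reflect N Y y = begin
  β N Y + -1^ N * β N (- y)                      ≡⟨ cong (β N Y +_) (∑-distribˡ-* N (-1^ N) (λ i → c i * (- y) ^ℚ suc i)) ⟩
  β N Y + ∑[ i < N ] (-1^ N * (c i * (- y) ^ℚ suc i)) ≡⟨ sym (∑-distrib-+ N _ _) ⟩
  ∑[ i < N ] (c i * Y ^ℚ suc i + -1^ N * (c i * (- y) ^ℚ suc i)) ≡⟨ ∑-cong-< N term ⟩
  Φ N (Y ^ℚ_) (y ^ℚ_)                            ∎
  where
  open ≡-Reasoning
  c : ℕ → ℚ
  c i = ι (N C suc i) * B (N ∸ suc i)
  term : ∀ i → i ℕ.< N →
    c i * Y ^ℚ suc i + -1^ N * (c i * (- y) ^ℚ suc i) ≡ ι (N C suc i) * (Y ^ℚ suc i + -1^ (N ∸ suc i) * y ^ℚ suc i) * B (N ∸ suc i)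
  term i i<N = begin
    c i * Y ^ℚ e + -1^ N * (c i * (- y) ^ℚ e)          ≡⟨ cong (λ z → c i * Y ^ℚ e + -1^ N * (c i * z)) (neg-^ℚ y e) ⟩
    c i * Y ^ℚ e + -1^ N * (c i * (-1^ e * y ^ℚ e))    ≡⟨ regroup (ι (N C e)) (B (N ∸ e)) (Y ^ℚ e) (y ^ℚ e) (-1^ N) (-1^ e) ⟩
    ι (N C e) * (Y ^ℚ e + (-1^ N * -1^ e) * y ^ℚ e) * B (N ∸ e) ≡⟨ cong (λ z → ι (N C e) * (Y ^ℚ e + z * y ^ℚ e) * B (N ∸ e)) (sym (-1^[m∸n]≡-1^m*-1^n i<N)) ⟩
    ι (N C e) * (Y ^ℚ e + -1^ (N ∸ e) * y ^ℚ e) * B (N ∸ e) ∎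
    where
    e : ℕ
    e = suc i
    regroup : ∀ (a b P Q σ τ : ℚ) → a * b * P + σ * (a * b * (τ * Q)) ≡ a * (P + (σ * τ) * Q) * b
    regroup = solve-∀ ℚ-ring

Σpow-Φ : ∀ N n → 2 ≤ N → ι (2 ℕ.* N) * Σpow n (N ∸ 1) ≡ Φ N (ι (suc n) ^ℚ_) (ι n ^ℚ_)
Σpow-Φ (suc zero) n (s≤s ())
Σpow-Φ (suc (suc q)) n _ = trans (Σpow-symmetric q n) (β-reflect (suc (suc q)) (ι (suc n)) (ι n))

∑-shifted-powers : ∀ n e → ∑[ i < n ] (ι (suc (suc i)) ^ℚ e) ≡ Σpow n e + (ι (suc n) ^ℚ e - 1ℚ)
∑-shifted-powers n e = begin
  ∑[ i < n ] f (suc i)               ≡⟨ cancel-first (f 0) (∑[ i < n ] f (suc i)) (∑ n f) (f n) (∑-last n f) ⟩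
  ∑ n f + (f n - f 0)                ≡⟨ cong₂ (λ u v → u + (f n - v)) (sym (sumFrom≡∑ 1 n (λ i → ι i ^ℚ e))) (1^ℚ≡1 e) ⟩
  Σpow n e + (ι (suc n) ^ℚ e - 1ℚ)   ∎
  where
  open ≡-Reasoning
  f : ℕ → ℚ
  f i = ι (suc i) ^ℚ e
  cancel-first : ∀ a x s l → a + x ≡ s + l → x ≡ s + (l - a)
  cancel-first a x s l eq = begin
    x               ≡⟨ add-sub a x ⟩
    (a + x) - a     ≡⟨ cong (_- a) eq ⟩
    (s + l) - a     ≡⟨ +-assoc s l (- a) ⟩
    s + (l - a)     ∎
    where
    add-sub : ∀ a x → x ≡ (a + x) - a
    add-sub = solve-∀ ℚ-ring

Σ²pow-Φ : ∀ N n → 2 ≤ N → ι (2 ℕ.* N) * Σ²pow n (N ∸ 1) ≡ Φ N (λ e → Σpow n e + (ι (suc n) ^ℚ e - 1ℚ)) (Σpow n)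
Σ²pow-Φ N n 2≤N = begin
  ι (2 ℕ.* N) * Σ²pow n p                                ≡⟨ cong (ι (2 ℕ.* N) *_) (sumFrom≡∑ 1 n (λ i → Σpow i p)) ⟩
  ι (2 ℕ.* N) * ∑[ i < n ] Σpow (suc i) p                ≡⟨ ∑-distribˡ-* n (ι (2 ℕ.* N)) (λ i → Σpow (suc i) p) ⟩
  ∑[ i < n ] (ι (2 ℕ.* N) * Σpow (suc i) p)              ≡⟨ ∑-cong n (λ i → Σpow-Φ N (suc i) 2≤N) ⟩
  ∑[ i < n ] Φ N (ι (suc (suc i)) ^ℚ_) (ι (suc i) ^ℚ_)   ≡⟨ ∑-Φ n N (λ i → ι (suc (suc i)) ^ℚ_) (λ i → ι (suc i) ^ℚ_) ⟩
  Φ N (λ e → ∑[ i < n ] (ι (suc (suc i)) ^ℚ e)) (λ e → ∑[ i < n ] (ι (suc i) ^ℚ e))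
                                                          ≡⟨ Φ-cong N (∑-shifted-powers n) (λ e → sym (sumFrom≡∑ 1 n (λ i → ι i ^ℚ e))) ⟩
  Φ N (λ e → Σpow n e + (ι (suc n) ^ℚ e - 1ℚ)) (Σpow n)   ∎
  where
  open ≡-Reasoning
  p : ℕ
  p = N ∸ 1

Φ-term-− : ∀ N F G e → -1^ (N ∸ e) ≡ - 1ℚ → Φ-term N F G e ≡ ι (N C e) * (F e - G e) * B (N ∸ e)
Φ-term-− N F G e sign = cong (λ z → ι (N C e) * z * B (N ∸ e)) (trans (cong (λ s → F e + s * G e) sign) (cong (F e +_) (-1*x≡-x (G e))))

Φ-term-+ : ∀ N F G e → -1^ (N ∸ e) ≡ 1ℚ → Φ-term N F G e ≡ ι (N C e) * (F e + G e) * B (N ∸ e)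
Φ-term-+ N F G e sign = cong (λ z → ι (N C e) * z * B (N ∸ e)) (trans (cong (λ s → F e + s * G e) sign) (cong (F e +_) (*-identityˡ (G e))))

-- Splitting by parity

2[1+j]∸1≡1+2j : ∀ j → 2 ℕ.* suc j ∸ 1 ≡ suc (2 ℕ.* j)
2[1+j]∸1≡1+2j j = cong (_∸ 1) (ℕ.*-suc 2 j)

2+2j≤2m : ∀ {j m} → j ℕ.< m → suc (suc (2 ℕ.* j)) ≤ 2 ℕ.* m
2+2j≤2m {j} {m} j<m = subst (_≤ 2 ℕ.* m) (ℕ.*-suc 2 j) (ℕ.*-monoʳ-≤ 2 j<m)

Φ-even : ∀ m F G → Φ (2 ℕ.* m) F G ≡
    sumFrom 1 m (λ j → ι ((2 ℕ.* m) C (2 ℕ.* j ∸ 1)) * (F (2 ℕ.* j ∸ 1) - G (2 ℕ.* j ∸ 1)) * B (2 ℕ.* m ℕ.+ 1 ∸ 2 ℕ.* j))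
  + sumFrom 1 m (λ j → ι ((2 ℕ.* m) C (2 ℕ.* j)) * (F (2 ℕ.* j) + G (2 ℕ.* j)) * B (2 ℕ.* m ∸ 2 ℕ.* j))
Φ-even m F G = begin
  ∑ (2 ℕ.* m) (φ ∘ suc)
    ≡⟨ ∑-split-parity m (φ ∘ suc) ⟩
  ∑[ j < m ] φ (suc (2 ℕ.* j)) + ∑[ j < m ] φ (suc (suc (2 ℕ.* j)))
    ≡⟨ cong₂ _+_ (∑-cong-< m odd) (∑-cong-< m even) ⟩
  ∑[ j < m ] odd-summand (suc j) + ∑[ j < m ] even-summand (suc j)
    ≡⟨ sym (cong₂ _+_ (sumFrom≡∑ 1 m odd-summand) (sumFrom≡∑ 1 m even-summand)) ⟩
  sumFrom 1 m odd-summand + sumFrom 1 m even-summand ∎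
  where
  open ≡-Reasoning
  N : ℕ
  N = 2 ℕ.* m
  φ : ℕ → ℚ
  φ = Φ-term N F G
  odd-summand even-summand : ℕ → ℚ
  odd-summand j = ι (N C (2 ℕ.* j ∸ 1)) * (F (2 ℕ.* j ∸ 1) - G (2 ℕ.* j ∸ 1)) * B (N ℕ.+ 1 ∸ 2 ℕ.* j)
  even-summand j = ι (N C (2 ℕ.* j)) * (F (2 ℕ.* j) + G (2 ℕ.* j)) * B (N ∸ 2 ℕ.* j)
  odd : ∀ j → j ℕ.< m → φ (suc (2 ℕ.* j)) ≡ odd-summand (suc j)
  odd j j<m = begin
    φ e                                    ≡⟨ Φ-term-− N F G e (trans (-1^[2m∸k]≡-1^k m (ℕ.<⇒≤ (2+2j≤2m j<m))) (-1^[1+2n]≡-1 j)) ⟩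
    ι (N C e) * (F e - G e) * B (N ∸ e)    ≡⟨ cong₂ (λ e′ b → ι (N C e′) * (F e′ - G e′) * B b)
                                                    (sym (2[1+j]∸1≡1+2j j)) (sym (cong₂ _∸_ (ℕ.+-comm N 1) (ℕ.*-suc 2 j))) ⟩
    odd-summand (suc j)                    ∎
    where
    e : ℕ
    e = suc (2 ℕ.* j)
  even : ∀ j → j ℕ.< m → φ (suc (suc (2 ℕ.* j))) ≡ even-summand (suc j)
  even j j<m = begin
    φ e                                    ≡⟨ Φ-term-+ N F G e (trans (-1^[2m∸k]≡-1^k m (2+2j≤2m j<m)) (-1^[2+2n]≡1 j)) ⟩
    ι (N C e) * (F e + G e) * B (N ∸ e)    ≡⟨ cong (λ e′ → ι (N C e′) * (F e′ + G e′) * B (N ∸ e′)) (sym (ℕ.*-suc 2 j)) ⟩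
    even-summand (suc j)                   ∎
    where
    e : ℕ
    e = suc (suc (2 ℕ.* j))

Φ-odd : ∀ m F G → Φ (2 ℕ.* m ℕ.+ 1) F G ≡
    sumFrom 1 (m ℕ.+ 1) (λ j → ι ((2 ℕ.* m ℕ.+ 1) C (2 ℕ.* j ∸ 1)) * (F (2 ℕ.* j ∸ 1) + G (2 ℕ.* j ∸ 1)) * B (2 ℕ.* m ℕ.+ 2 ∸ 2 ℕ.* j))
  + sumFrom 1 m (λ j → ι ((2 ℕ.* m ℕ.+ 1) C (2 ℕ.* j)) * (F (2 ℕ.* j) - G (2 ℕ.* j)) * B (2 ℕ.* m ℕ.+ 1 ∸ 2 ℕ.* j))
Φ-odd m F G = begin
  ∑ N (φ ∘ suc)
    ≡⟨ cong (λ l → ∑ l (φ ∘ suc)) (ℕ.+-comm (2 ℕ.* m) 1) ⟩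
  ∑ (suc (2 ℕ.* m)) (φ ∘ suc)
    ≡⟨ ∑-split-parity-suc m (φ ∘ suc) ⟩
  ∑[ j < suc m ] φ (suc (2 ℕ.* j)) + ∑[ j < m ] φ (suc (suc (2 ℕ.* j)))
    ≡⟨ cong₂ _+_ (∑-cong-< (suc m) (λ j j≤m → odd j (ℕ.≤-pred j≤m))) (∑-cong-< m even) ⟩
  ∑[ j < suc m ] odd-summand (suc j) + ∑[ j < m ] even-summand (suc j)
    ≡⟨ cong (λ l → ∑ l (odd-summand ∘ suc) + ∑ m (even-summand ∘ suc)) (ℕ.+-comm 1 m) ⟩
  ∑[ j < m ℕ.+ 1 ] odd-summand (suc j) + ∑[ j < m ] even-summand (suc j)
    ≡⟨ sym (cong₂ _+_ (sumFrom≡∑ 1 (m ℕ.+ 1) odd-summand) (sumFrom≡∑ 1 m even-summand)) ⟩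
  sumFrom 1 (m ℕ.+ 1) odd-summand + sumFrom 1 m even-summand ∎
  where
  open ≡-Reasoning
  N : ℕ
  N = 2 ℕ.* m ℕ.+ 1
  φ : ℕ → ℚ
  φ = Φ-term N F G
  odd-summand even-summand : ℕ → ℚ
  odd-summand j = ι (N C (2 ℕ.* j ∸ 1)) * (F (2 ℕ.* j ∸ 1) + G (2 ℕ.* j ∸ 1)) * B (2 ℕ.* m ℕ.+ 2 ∸ 2 ℕ.* j)
  even-summand j = ι (N C (2 ℕ.* j)) * (F (2 ℕ.* j) - G (2 ℕ.* j)) * B (N ∸ 2 ℕ.* j)
  -1^N∸suc : ∀ k → -1^ (N ∸ suc k) ≡ -1^ (2 ℕ.* m ∸ k)
  -1^N∸suc k = cong (λ n → -1^ (n ∸ suc k)) (ℕ.+-comm (2 ℕ.* m) 1)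
  odd : ∀ j → j ≤ m → φ (suc (2 ℕ.* j)) ≡ odd-summand (suc j)
  odd j j≤m = begin
    φ e                                    ≡⟨ Φ-term-+ N F G e (trans (-1^N∸suc (2 ℕ.* j)) (trans (-1^[2m∸k]≡-1^k m (ℕ.*-monoʳ-≤ 2 j≤m)) (-1^[2n]≡1 j))) ⟩
    ι (N C e) * (F e + G e) * B (N ∸ e)    ≡⟨ cong₂ (λ e′ b → ι (N C e′) * (F e′ + G e′) * B b)
                                                    (sym (2[1+j]∸1≡1+2j j)) (sym (cong₂ _∸_ (ℕ.+-suc (2 ℕ.* m) 1) (ℕ.*-suc 2 j))) ⟩
    odd-summand (suc j)                    ∎
    where
    e : ℕ
    e = suc (2 ℕ.* j)
  even : ∀ j → j ℕ.< m → φ (suc (suc (2 ℕ.* j))) ≡ even-summand (suc j)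
  even j j<m = begin
    φ e                                    ≡⟨ Φ-term-− N F G e (trans (-1^N∸suc (suc (2 ℕ.* j))) (trans (-1^[2m∸k]≡-1^k m (ℕ.<⇒≤ (2+2j≤2m j<m))) (-1^[1+2n]≡-1 j))) ⟩
    ι (N C e) * (F e - G e) * B (N ∸ e)    ≡⟨ cong (λ e′ → ι (N C e′) * (F e′ - G e′) * B (N ∸ e′)) (sym (ℕ.*-suc 2 j)) ⟩
    even-summand (suc j)                   ∎
    where
    e : ℕ
    e = suc (suc (2 ℕ.* j))

-- Inverted polynomials

polyInv : ℕ → (ℕ → ℕ) → ℚ → ℚ
polyInv n g x = sumFrom 0 n (λ k → ι (g k) * x ^ℚ (n ∸ k))

polyInv-∑ : ∀ n g x → polyInv n g x ≡ ∑[ k < suc n ] (ι (g k) * x ^ℚ (n ∸ k))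
polyInv-∑ n g x = sumFrom≡∑ 0 n (λ k → ι (g k) * x ^ℚ (n ∸ k))

polyInv-cong : ∀ n {g h} x → (∀ k → k ≤ n → g k ≡ h k) → polyInv n g x ≡ polyInv n h x
polyInv-cong n {g} {h} x g≗h = begin
  polyInv n g x                        ≡⟨ polyInv-∑ n g x ⟩
  ∑[ k < suc n ] (ι (g k) * x ^ℚ (n ∸ k)) ≡⟨ ∑-cong-< (suc n) (λ k k≤n → cong (λ c → ι c * x ^ℚ (n ∸ k)) (g≗h k (ℕ.≤-pred k≤n))) ⟩
  ∑[ k < suc n ] (ι (h k) * x ^ℚ (n ∸ k)) ≡⟨ sym (polyInv-∑ n h x) ⟩
  polyInv n h x                        ∎
  where open ≡-Reasoning

polyInv-+ : ∀ n g h x → polyInv n (λ k → g k ℕ.+ h k) x ≡ polyInv n g x + polyInv n h x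
polyInv-+ n g h x = begin
  polyInv n (λ k → g k ℕ.+ h k) x
    ≡⟨ polyInv-∑ n (λ k → g k ℕ.+ h k) x ⟩
  ∑[ k < suc n ] (ι (g k ℕ.+ h k) * x ^ℚ (n ∸ k))
    ≡⟨ ∑-cong (suc n) (λ k → trans (cong (_* x ^ℚ (n ∸ k)) (ι-+ (g k) (h k))) (*-distribʳ-+ (x ^ℚ (n ∸ k)) (ι (g k)) (ι (h k)))) ⟩
  ∑[ k < suc n ] (ι (g k) * x ^ℚ (n ∸ k) + ι (h k) * x ^ℚ (n ∸ k))
    ≡⟨ ∑-distrib-+ (suc n) (λ k → ι (g k) * x ^ℚ (n ∸ k)) (λ k → ι (h k) * x ^ℚ (n ∸ k)) ⟩
  ∑[ k < suc n ] (ι (g k) * x ^ℚ (n ∸ k)) + ∑[ k < suc n ] (ι (h k) * x ^ℚ (n ∸ k))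
    ≡⟨ sym (cong₂ _+_ (polyInv-∑ n g x) (polyInv-∑ n h x)) ⟩
  polyInv n g x + polyInv n h x ∎
  where open ≡-Reasoning

polyInv-suc : ∀ n g x → polyInv (suc n) g x ≡ x * polyInv n g x + ι (g (suc n))
polyInv-suc n g x = begin
  polyInv (suc n) g x
    ≡⟨ polyInv-∑ (suc n) g x ⟩
  ∑[ k < suc (suc n) ] (ι (g k) * x ^ℚ (suc n ∸ k))
    ≡⟨ ∑-last (suc n) (λ k → ι (g k) * x ^ℚ (suc n ∸ k)) ⟩
  ∑[ k < suc n ] (ι (g k) * x ^ℚ (suc n ∸ k)) + ι (g (suc n)) * x ^ℚ (suc n ∸ suc n)
    ≡⟨ cong₂ _+_ (∑-cong-< (suc n) (λ k k≤n → lower k (ℕ.≤-pred k≤n))) top ⟩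
  ∑[ k < suc n ] (x * (ι (g k) * x ^ℚ (n ∸ k))) + ι (g (suc n))
    ≡⟨ cong (_+ ι (g (suc n))) (sym (trans (cong (x *_) (polyInv-∑ n g x)) (∑-distribˡ-* (suc n) x (λ k → ι (g k) * x ^ℚ (n ∸ k))))) ⟩
  x * polyInv n g x + ι (g (suc n)) ∎
  where
  open ≡-Reasoning
  lower : ∀ k → k ≤ n → ι (g k) * x ^ℚ (suc n ∸ k) ≡ x * (ι (g k) * x ^ℚ (n ∸ k))
  lower k k≤n = trans (cong (λ e → ι (g k) * x ^ℚ e) (ℕ.+-∸-assoc 1 k≤n)) (x*[y*z]≡y*[x*z] (ι (g k)) x (x ^ℚ (n ∸ k)))
    where
    x*[y*z]≡y*[x*z] : ∀ (a b c : ℚ) → a * (b * c) ≡ b * (a * c)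
    x*[y*z]≡y*[x*z] = solve-∀ ℚ-ring
  top : ι (g (suc n)) * x ^ℚ (suc n ∸ suc n) ≡ ι (g (suc n))
  top = trans (cong (λ e → ι (g (suc n)) * x ^ℚ e) (ℕ.n∸n≡0 n)) (*-identityʳ (ι (g (suc n))))

polyInv-suc-noConst : ∀ n g x → g (suc n) ≡ 0 → polyInv (suc n) g x ≡ x * polyInv n g x
polyInv-suc-noConst n g x g[n+1]≡0 =
  trans (polyInv-suc n g x) (trans (cong (λ c → x * polyInv n g x + ι c) g[n+1]≡0) (+-identityʳ _))

polyInv-suc-noLead : ∀ n g x → g 0 ≡ 0 → polyInv (suc n) g x ≡ polyInv n (g ∘ suc) x
polyInv-suc-noLead n g x g0≡0 = begin
  polyInv (suc n) g x                  ≡⟨ polyInv-∑ (suc n) g x ⟩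
  ι (g 0) * x ^ℚ suc n + rest          ≡⟨ cong (λ c → ι c * x ^ℚ suc n + rest) g0≡0 ⟩
  0ℚ * x ^ℚ suc n + rest               ≡⟨ trans (cong (_+ rest) (*-zeroˡ (x ^ℚ suc n))) (+-identityˡ rest) ⟩
  rest                                 ≡⟨ sym (polyInv-∑ n (g ∘ suc) x) ⟩
  polyInv n (g ∘ suc) x                ∎
  where
  open ≡-Reasoning
  rest : ℚ
  rest = ∑[ k < suc n ] (ι (g (suc k)) * x ^ℚ (n ∸ k))

evenC oddC : ℕ → ℕ → ℕ
evenC j k = (j ℕ.+ k) C (2 ℕ.* k)
oddC j k = (j ℕ.+ k) C suc (2 ℕ.* k)

oddC-pascal : ∀ j k → oddC (suc j) k ≡ evenC j k ℕ.+ oddC j k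
oddC-pascal j k = sym (nCk+nC[k+1]≡[n+1]C[k+1] (j ℕ.+ k) (2 ℕ.* k))

evenC-pascal : ∀ j k → evenC (suc j) (suc k) ≡ evenC j (suc k) ℕ.+ oddC (suc j) k
evenC-pascal j k = begin
  (suc j ℕ.+ suc k) C (2 ℕ.* suc k)                           ≡⟨ cong (suc (j ℕ.+ suc k) C_) (ℕ.*-suc 2 k) ⟩
  suc (j ℕ.+ suc k) C suc (suc (2 ℕ.* k))                     ≡⟨ sym (nCk+nC[k+1]≡[n+1]C[k+1] (j ℕ.+ suc k) (suc (2 ℕ.* k))) ⟩
  (j ℕ.+ suc k) C suc (2 ℕ.* k) ℕ.+ (j ℕ.+ suc k) C suc (suc (2 ℕ.* k))
                                                              ≡⟨ ℕ.+-comm ((j ℕ.+ suc k) C suc (2 ℕ.* k)) _ ⟩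
  (j ℕ.+ suc k) C suc (suc (2 ℕ.* k)) ℕ.+ (j ℕ.+ suc k) C suc (2 ℕ.* k)
                                                              ≡⟨ cong₂ ℕ._+_ (cong ((j ℕ.+ suc k) C_) (sym (ℕ.*-suc 2 k)))
                                                                             (cong (λ n → n C suc (2 ℕ.* k)) (ℕ.+-suc j k)) ⟩
  evenC j (suc k) ℕ.+ oddC (suc j) k                          ∎
  where open ≡-Reasoning

evenC-top : ∀ j → evenC j (suc j) ≡ 0
evenC-top j = k>n⇒nCk≡0 (ℕ.≤-reflexive (trans (cong suc (ℕ.+-suc j j)) (sym (trans (ℕ.*-suc 2 j) (cong (suc ∘ suc) (cong (j ℕ.+_) (ℕ.+-identityʳ j)))))))

oddC-top : ∀ j → oddC j j ≡ 0
oddC-top j = k>n⇒nCk≡0 (s≤s (ℕ.≤-reflexive (cong (j ℕ.+_) (sym (ℕ.+-identityʳ j)))))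

-- With a = b + 1 and x = ab, c j = 𝒫^Inv_j(x) and d j = 𝒬^Inv_j(x) for j ≥ 1; d 0 = 0 rather than
-- 𝒬^Inv_0 = 1 so that the recurrences hold.  Carrying c j = a d j + b^{2j} along with
-- (a + b) d j = a^{2j} − b^{2j} avoids dividing by a + b.
module Lucas (b : ℚ) where
  a x s : ℚ
  a = b + 1ℚ
  x = b * a
  s = a + b

  c d : ℕ → ℚ
  c j = polyInv j (evenC j) x
  d zero = 0ℚ
  d (suc j) = polyInv j (oddC (suc j)) x

  polyInv-oddC : ∀ j → polyInv j (oddC j) x ≡ x * d j
  polyInv-oddC zero = sym (*-zeroʳ x)
  polyInv-oddC (suc j) = polyInv-suc-noConst j (oddC (suc j)) x (oddC-top (suc j))

  d-suc : ∀ j → d (suc j) ≡ c j + x * d j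
  d-suc j = trans (polyInv-cong j x (λ k _ → oddC-pascal j k))
                  (trans (polyInv-+ j (evenC j) (oddC j) x) (cong (c j +_) (polyInv-oddC j)))

  c-suc : ∀ j → c (suc j) ≡ x * c j + d (suc j)
  c-suc j = begin
    polyInv (suc j) (evenC (suc j)) x                    ≡⟨ polyInv-cong (suc j) x split ⟩
    polyInv (suc j) (λ k → evenC j k ℕ.+ g k) x          ≡⟨ polyInv-+ (suc j) (evenC j) g x ⟩
    polyInv (suc j) (evenC j) x + polyInv (suc j) g x    ≡⟨ cong₂ _+_ (polyInv-suc-noConst j (evenC j) x (evenC-top j))
                                                                      (polyInv-suc-noLead j g x refl) ⟩
    x * c j + d (suc j)                                  ∎
    where
    open ≡-Reasoning
    g : ℕ → ℕ
    g zero = 0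
    g (suc k) = oddC (suc j) k
    split : ∀ k → k ≤ suc j → evenC (suc j) k ≡ evenC j k ℕ.+ g k
    split zero _ = refl
    split (suc k) _ = evenC-pascal j k

  invariant : ∀ j → (s * d j ≡ a ^ℚ (2 ℕ.* j) - b ^ℚ (2 ℕ.* j)) × (c j ≡ a * d j + b ^ℚ (2 ℕ.* j))
  invariant zero = zero-case₁ b , zero-case₂ b
    where
    zero-case₁ : ∀ b → ((b + 1ℚ) + b) * 0ℚ ≡ 1ℚ - 1ℚ
    zero-case₁ = solve-∀ ℚ-ring
    zero-case₂ : ∀ b → 1ℚ ≡ (b + 1ℚ) * 0ℚ + 1ℚ
    zero-case₂ = solve-∀ ℚ-ring
  invariant (suc j) = s*d[1+j] , c[1+j]
    where
    open ≡-Reasoning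
    P : ℚ
    P = a ^ℚ (2 ℕ.* j)
    Q : ℚ
    Q = b ^ℚ (2 ℕ.* j)
    IH₁ : s * d j ≡ P - Q
    IH₁ = proj₁ (invariant j)
    IH₂ : c j ≡ a * d j + Q
    IH₂ = proj₂ (invariant j)
    a^[2+2j] : a ^ℚ (2 ℕ.* suc j) ≡ a * (a * P)
    a^[2+2j] = cong (a ^ℚ_) (ℕ.*-suc 2 j)
    b^[2+2j] : b ^ℚ (2 ℕ.* suc j) ≡ b * (b * Q)
    b^[2+2j] = cong (b ^ℚ_) (ℕ.*-suc 2 j)
    s*d[1+j] : s * d (suc j) ≡ a ^ℚ (2 ℕ.* suc j) - b ^ℚ (2 ℕ.* suc j)
    s*d[1+j] = begin
      s * d (suc j)                     ≡⟨ cong (s *_) (d-suc j) ⟩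
      s * (c j + x * d j)               ≡⟨ cong (λ z → s * (z + x * d j)) IH₂ ⟩
      s * ((a * d j + Q) + x * d j)     ≡⟨ ring₁ b (d j) Q ⟩
      (a + x) * (s * d j) + s * Q       ≡⟨ cong (λ z → (a + x) * z + s * Q) IH₁ ⟩
      (a + x) * (P - Q) + s * Q         ≡⟨ ring₂ b P Q ⟩
      a * (a * P) - b * (b * Q)         ≡⟨ sym (cong₂ _-_ a^[2+2j] b^[2+2j]) ⟩
      a ^ℚ (2 ℕ.* suc j) - b ^ℚ (2 ℕ.* suc j) ∎
      where
      ring₁ : ∀ (b d Q : ℚ) → let a = b + 1ℚ; x = b * a; s = a + b in
              s * ((a * d + Q) + x * d) ≡ (a + x) * (s * d) + s * Q
      ring₁ = solve-∀ ℚ-ring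
      ring₂ : ∀ (b P Q : ℚ) → let a = b + 1ℚ; x = b * a; s = a + b in
              (a + x) * (P - Q) + s * Q ≡ a * (a * P) - b * (b * Q)
      ring₂ = solve-∀ ℚ-ring
    c[1+j] : c (suc j) ≡ a * d (suc j) + b ^ℚ (2 ℕ.* suc j)
    c[1+j] = begin
      c (suc j)                                 ≡⟨ c-suc j ⟩
      x * c j + d (suc j)                       ≡⟨ cong (x * c j +_) (d-suc j) ⟩
      x * c j + (c j + x * d j)                 ≡⟨ cong (λ z → x * z + (z + x * d j)) IH₂ ⟩
      x * (a * d j + Q) + ((a * d j + Q) + x * d j) ≡⟨ ring₃ b (d j) Q ⟩
      a * ((a * d j + Q) + x * d j) + b * (b * Q) ≡⟨ cong₂ (λ z w → a * (z + x * d j) + w) (sym IH₂) (sym b^[2+2j]) ⟩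
      a * (c j + x * d j) + b ^ℚ (2 ℕ.* suc j)  ≡⟨ cong (λ z → a * z + b ^ℚ (2 ℕ.* suc j)) (sym (d-suc j)) ⟩
      a * d (suc j) + b ^ℚ (2 ℕ.* suc j)        ∎
      where
      ring₃ : ∀ (b d Q : ℚ) → let a = b + 1ℚ; x = b * a in
              x * (a * d + Q) + ((a * d + Q) + x * d) ≡ a * ((a * d + Q) + x * d) + b * (b * Q)
      ring₃ = solve-∀ ℚ-ring

  module _ (j : ℕ) where
    private
      P : ℚ
      P = a ^ℚ (2 ℕ.* j)
      Q : ℚ
      Q = b ^ℚ (2 ℕ.* j)
      IH₁ : s * d j ≡ P - Q
      IH₁ = proj₁ (invariant j)
      IH₂ : c j ≡ a * d j + Q
      IH₂ = proj₂ (invariant j)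
      open ≡-Reasoning

    PInv-closed : PInv j x ≡ a ^ℚ suc (2 ℕ.* j) - b ^ℚ suc (2 ℕ.* j)
    PInv-closed = begin
      polyInv j (λ k → T k j) x                        ≡⟨ polyInv-cong j x (λ k _ → T≡oddC k) ⟩
      polyInv j (λ k → oddC (suc j) k ℕ.+ oddC j k) x  ≡⟨ polyInv-+ j (oddC (suc j)) (oddC j) x ⟩
      d (suc j) + polyInv j (oddC j) x                 ≡⟨ cong₂ _+_ (d-suc j) (polyInv-oddC j) ⟩
      (c j + x * d j) + x * d j                        ≡⟨ cong (λ z → (z + x * d j) + x * d j) IH₂ ⟩
      ((a * d j + Q) + x * d j) + x * d j              ≡⟨ ring₁ b (d j) Q ⟩
      a * (s * d j) + Q                                ≡⟨ cong (λ z → a * z + Q) IH₁ ⟩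
      a * (P - Q) + Q                                  ≡⟨ ring₂ b P Q ⟩
      a * P - b * Q                                    ∎
      where
      T≡oddC : ∀ k → T k j ≡ oddC (suc j) k ℕ.+ oddC j k
      T≡oddC k = cong₂ (λ n e → (n C e) ℕ.+ ((j ℕ.+ k) C e)) (ℕ.+-comm (j ℕ.+ k) 1) (ℕ.+-comm (2 ℕ.* k) 1)
      ring₁ : ∀ (b d Q : ℚ) → let a = b + 1ℚ; x = b * a; s = a + b in
              ((a * d + Q) + x * d) + x * d ≡ a * (s * d) + Q
      ring₁ = solve-∀ ℚ-ring
      ring₂ : ∀ (b P Q : ℚ) → let a = b + 1ℚ in a * (P - Q) + Q ≡ a * P - b * Q
      ring₂ = solve-∀ ℚ-ring

    QInv-closed : QInv (suc j) x ≡ a ^ℚ (2 ℕ.* suc j) + b ^ℚ (2 ℕ.* suc j)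
    QInv-closed = begin
      polyInv (suc j) (λ k → U k (suc j)) x                   ≡⟨ polyInv-cong (suc j) x U≡evenC ⟩
      polyInv (suc j) (λ k → evenC (suc j) k ℕ.+ evenC j k) x ≡⟨ polyInv-+ (suc j) (evenC (suc j)) (evenC j) x ⟩
      c (suc j) + polyInv (suc j) (evenC j) x                 ≡⟨ cong₂ _+_ (trans (c-suc j) (cong (x * c j +_) (d-suc j)))
                                                                           (polyInv-suc-noConst j (evenC j) x (evenC-top j)) ⟩
      (x * c j + (c j + x * d j)) + x * c j                   ≡⟨ cong (λ z → (x * z + (z + x * d j)) + x * z) IH₂ ⟩
      (x * (a * d j + Q) + ((a * d j + Q) + x * d j)) + x * (a * d j + Q)
                                                              ≡⟨ ring₁ b (d j) Q ⟩
      a * a * (s * d j) + (x + x + 1ℚ) * Q                    ≡⟨ cong (λ z → a * a * z + (x + x + 1ℚ) * Q) IH₁ ⟩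
      a * a * (P - Q) + (x + x + 1ℚ) * Q                      ≡⟨ ring₂ b P Q ⟩
      a * (a * P) + b * (b * Q)                               ≡⟨ sym (cong₂ _+_ (cong (a ^ℚ_) (ℕ.*-suc 2 j)) (cong (b ^ℚ_) (ℕ.*-suc 2 j))) ⟩
      a ^ℚ (2 ℕ.* suc j) + b ^ℚ (2 ℕ.* suc j)                 ∎
      where
      U≡evenC : ∀ k → k ≤ suc j → U k (suc j) ≡ evenC (suc j) k ℕ.+ evenC j k
      U≡evenC zero _ = refl
      U≡evenC (suc k) _ = refl
      ring₁ : ∀ (b d Q : ℚ) → let a = b + 1ℚ; x = b * a; s = a + b in
              (x * (a * d + Q) + ((a * d + Q) + x * d)) + x * (a * d + Q) ≡ a * a * (s * d) + (x + x + 1ℚ) * Q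
      ring₁ = solve-∀ ℚ-ring
      ring₂ : ∀ (b P Q : ℚ) → let a = b + 1ℚ; x = b * a in
              a * a * (P - Q) + (x + x + 1ℚ) * Q ≡ a * (a * P) + b * (b * Q)
      ring₂ = solve-∀ ℚ-ring

    cPInv-closed : s * cPInv j x ≡ a ^ℚ suc (2 ℕ.* j) + b ^ℚ suc (2 ℕ.* j)
    cPInv-closed = begin
      s * c j                 ≡⟨ cong (s *_) IH₂ ⟩
      s * (a * d j + Q)       ≡⟨ ring₁ b (d j) Q ⟩
      a * (s * d j) + s * Q   ≡⟨ cong (λ z → a * z + s * Q) IH₁ ⟩
      a * (P - Q) + s * Q     ≡⟨ ring₂ b P Q ⟩
      a * P + b * Q           ∎
      where
      ring₁ : ∀ (b d Q : ℚ) → let a = b + 1ℚ; s = a + b in s * (a * d + Q) ≡ a * (s * d) + s * Q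
      ring₁ = solve-∀ ℚ-ring
      ring₂ : ∀ (b P Q : ℚ) → let a = b + 1ℚ; s = a + b in a * (P - Q) + s * Q ≡ a * P + b * Q
      ring₂ = solve-∀ ℚ-ring

    cQInv-closed : s * cQInv (suc j) x ≡ a ^ℚ (2 ℕ.* suc j) - b ^ℚ (2 ℕ.* suc j)
    cQInv-closed = trans (cong (s *_) cQInv≡d) (proj₁ (invariant (suc j)))
      where
      cQInv≡d : cQInv (suc j) x ≡ d (suc j)
      cQInv≡d = begin
        cQInv (suc j) x
          ≡⟨ sumFrom≡∑ 1 (suc j) (λ k → ι ((suc j ℕ.+ k ∸ 1) C (2 ℕ.* k ∸ 1)) * x ^ℚ (suc j ∸ k)) ⟩
        ∑[ i < suc j ] (ι ((suc j ℕ.+ suc i ∸ 1) C (2 ℕ.* suc i ∸ 1)) * x ^ℚ (j ∸ i))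
          ≡⟨ ∑-cong (suc j) (λ i → cong (λ n → ι n * x ^ℚ (j ∸ i)) (cong₂ _C_ (ℕ.+-suc j i) (ℕ.+-suc i (i ℕ.+ 0)))) ⟩
        ∑[ i < suc j ] (ι (oddC (suc j) i) * x ^ℚ (j ∸ i))
          ≡⟨ sym (polyInv-∑ j (oddC (suc j)) x) ⟩
        d (suc j) ∎

module _ (n : ℕ) where
  open Lucas (ι n)

  private
    a≡ι[1+n] : a ≡ ι (suc n)
    a≡ι[1+n] = sym (ι-suc′ n)

    uQ≡x : uQ n ≡ x
    uQ≡x = trans (ι-* n (n ℕ.+ 1)) (cong (ι n *_) (ι-+ n 1))

    ι[2n+1]≡s : ι (2 ℕ.* n ℕ.+ 1) ≡ s
    ι[2n+1]≡s = begin
      ι (2 ℕ.* n ℕ.+ 1)             ≡⟨ ι-+ (2 ℕ.* n) 1 ⟩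
      ι (2 ℕ.* n) + 1ℚ              ≡⟨ cong (_+ 1ℚ) (ι[2n]≡ιn+ιn n) ⟩
      (ι n + ι n) + 1ℚ              ≡⟨ rearrange (ι n) ⟩
      (ι n + 1ℚ) + ι n              ∎
      where
      open ≡-Reasoning
      rearrange : ∀ y → (y + y) + 1ℚ ≡ (y + 1ℚ) + y
      rearrange = solve-∀ ℚ-ring

  PInv-at-u : ∀ j → PInv j (uQ n) ≡ ι (suc n) ^ℚ suc (2 ℕ.* j) - ι n ^ℚ suc (2 ℕ.* j)
  PInv-at-u j = trans (cong (PInv j) uQ≡x) (trans (PInv-closed j) (cong (λ a′ → a′ ^ℚ suc (2 ℕ.* j) - ι n ^ℚ suc (2 ℕ.* j)) a≡ι[1+n]))

  QInv-at-u : ∀ j → QInv (suc j) (uQ n) ≡ ι (suc n) ^ℚ (2 ℕ.* suc j) + ι n ^ℚ (2 ℕ.* suc j)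
  QInv-at-u j = trans (cong (QInv (suc j)) uQ≡x) (trans (QInv-closed j) (cong (λ a′ → a′ ^ℚ (2 ℕ.* suc j) + ι n ^ℚ (2 ℕ.* suc j)) a≡ι[1+n]))

  cPInv-at-u : ∀ j → ι (2 ℕ.* n ℕ.+ 1) * cPInv j (uQ n) ≡ ι (suc n) ^ℚ suc (2 ℕ.* j) + ι n ^ℚ suc (2 ℕ.* j)
  cPInv-at-u j = trans (cong₂ (λ s′ x′ → s′ * cPInv j x′) ι[2n+1]≡s uQ≡x)
                       (trans (cPInv-closed j) (cong (λ a′ → a′ ^ℚ suc (2 ℕ.* j) + ι n ^ℚ suc (2 ℕ.* j)) a≡ι[1+n]))

  cQInv-at-u : ∀ j → ι (2 ℕ.* n ℕ.+ 1) * cQInv (suc j) (uQ n) ≡ ι (suc n) ^ℚ (2 ℕ.* suc j) - ι n ^ℚ (2 ℕ.* suc j)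
  cQInv-at-u j = trans (cong₂ (λ s′ x′ → s′ * cQInv (suc j) x′) ι[2n+1]≡s uQ≡x)
                       (trans (cQInv-closed j) (cong (λ a′ → a′ ^ℚ (2 ℕ.* suc j) - ι n ^ℚ (2 ℕ.* suc j)) a≡ι[1+n]))

module _ (k : ℕ) where
  private
    n : ℕ
    n = suc k
    instance
      ι[1+k]≢0 : NonZero (ι n)
      ι[1+k]≢0 = pos⇒nonZero (ι n) {{normalize-pos n 1}}
    b : ℚ
    b = 1/ ι n

  open Lucas b

  private
    ι[1+k]*b≡1 : ι n * b ≡ 1ℚ
    ι[1+k]*b≡1 = *-inverseʳ (ι n)

    ι[1+k]*a≡ι[2+k] : ι n * a ≡ ι (suc n)
    ι[1+k]*a≡ι[2+k] = begin
      ι n * (b + 1ℚ)        ≡⟨ *-distribˡ-+ (ι n) b 1ℚ ⟩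
      ι n * b + ι n * 1ℚ    ≡⟨ cong₂ _+_ ι[1+k]*b≡1 (*-identityʳ (ι n)) ⟩
      1ℚ + ι n              ≡⟨ sym (ι-suc n) ⟩
      ι (suc n)             ∎
      where open ≡-Reasoning

    vQ*ι[1+k]²≡ι[2+k] : vQ n * (ι n * ι n) ≡ ι n + 1ℚ
    vQ*ι[1+k]²≡ι[2+k] = trans (cong (vQ n *_) (sym (ι-* n n))) (trans (p/d*d≡p (suc n) (k ℕ.+ k ℕ.* n)) (ι-suc′ n))

    vQ≡x : vQ n ≡ x
    vQ≡x = begin
      V                              ≡⟨ sym (*-identityʳ V) ⟩
      V * 1ℚ                         ≡⟨ cong (λ z → V * (z * z)) (sym ι[1+k]*b≡1) ⟩
      V * ((ι n * b) * (ι n * b))    ≡⟨ regroup V (ι n) b ⟩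
      V * (ι n * ι n) * (b * b)      ≡⟨ cong (_* (b * b)) vQ*ι[1+k]²≡ι[2+k] ⟩
      (ι n + 1ℚ) * (b * b)           ≡⟨ regroup′ (ι n) b ⟩
      (ι n * b) * b + b * b          ≡⟨ cong (λ z → z * b + b * b) ι[1+k]*b≡1 ⟩
      1ℚ * b + b * b                 ≡⟨ regroup″ b ⟩
      b * (b + 1ℚ)                   ∎
      where
      open ≡-Reasoning
      V : ℚ
      V = vQ n
      regroup : ∀ (v m c : ℚ) → v * ((m * c) * (m * c)) ≡ v * (m * m) * (c * c)
      regroup = solve-∀ ℚ-ring
      regroup′ : ∀ (m c : ℚ) → (m + 1ℚ) * (c * c) ≡ (m * c) * c + c * c
      regroup′ = solve-∀ ℚ-ring
      regroup″ : ∀ (c : ℚ) → 1ℚ * c + c * c ≡ c * (c + 1ℚ)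
      regroup″ = solve-∀ ℚ-ring

    ι[1+k]^e*[a^e-b^e] : ∀ e → ι n ^ℚ e * (a ^ℚ e - b ^ℚ e) ≡ ι (suc n) ^ℚ e - 1ℚ
    ι[1+k]^e*[a^e-b^e] e = begin
      ι n ^ℚ e * (a ^ℚ e - b ^ℚ e)                  ≡⟨ *-distribˡ-+ (ι n ^ℚ e) (a ^ℚ e) (- b ^ℚ e) ⟩
      ι n ^ℚ e * a ^ℚ e + ι n ^ℚ e * - b ^ℚ e       ≡⟨ cong (ι n ^ℚ e * a ^ℚ e +_) (sym (neg-distribʳ-* (ι n ^ℚ e) (b ^ℚ e))) ⟩
      ι n ^ℚ e * a ^ℚ e - ι n ^ℚ e * b ^ℚ e         ≡⟨ sym (cong₂ _-_ (^ℚ-distribʳ-* (ι n) a e) (^ℚ-distribʳ-* (ι n) b e)) ⟩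
      (ι n * a) ^ℚ e - (ι n * b) ^ℚ e               ≡⟨ cong₂ (λ u v → u ^ℚ e - v ^ℚ e) ι[1+k]*a≡ι[2+k] ι[1+k]*b≡1 ⟩
      ι (suc n) ^ℚ e - 1ℚ ^ℚ e                      ≡⟨ cong (λ z → ι (suc n) ^ℚ e - z) (1^ℚ≡1 e) ⟩
      ι (suc n) ^ℚ e - 1ℚ                           ∎
      where open ≡-Reasoning

    ι[2+k]≡ι[1+k]*s : ι (n ℕ.+ 2) ≡ ι n * s
    ι[2+k]≡ι[1+k]*s = begin
      ι (n ℕ.+ 2)             ≡⟨ ι-+ n 2 ⟩
      ι n + (1ℚ + 1ℚ)         ≡⟨ sym (+-assoc (ι n) 1ℚ 1ℚ) ⟩
      ι n + 1ℚ + 1ℚ           ≡⟨ sym (cong₂ _+_ (trans ι[1+k]*a≡ι[2+k] (ι-suc′ n)) ι[1+k]*b≡1) ⟩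
      ι n * a + ι n * b       ≡⟨ sym (*-distribˡ-+ (ι n) a b) ⟩
      ι n * s                 ∎
      where open ≡-Reasoning

  PInv-at-v : ∀ j → ι n ^ℚ suc (2 ℕ.* j) * PInv j (vQ n) ≡ ι (suc n) ^ℚ suc (2 ℕ.* j) - 1ℚ
  PInv-at-v j = trans (cong (λ x′ → ι n ^ℚ suc (2 ℕ.* j) * PInv j x′) vQ≡x)
                      (trans (cong (ι n ^ℚ suc (2 ℕ.* j) *_) (PInv-closed j)) (ι[1+k]^e*[a^e-b^e] (suc (2 ℕ.* j))))

  cQInv-at-v : ∀ j → ι (n ℕ.+ 2) * ι n ^ℚ suc (2 ℕ.* j) * cQInv (suc j) (vQ n) ≡ ι (suc n) ^ℚ (2 ℕ.* suc j) - 1ℚ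
  cQInv-at-v j = begin
    ι (n ℕ.+ 2) * ι n ^ℚ suc (2 ℕ.* j) * cQInv (suc j) (vQ n)
      ≡⟨ cong₂ (λ u x′ → u * ι n ^ℚ suc (2 ℕ.* j) * cQInv (suc j) x′) ι[2+k]≡ι[1+k]*s vQ≡x ⟩
    ι n * s * ι n ^ℚ suc (2 ℕ.* j) * cQInv (suc j) x
      ≡⟨ regroup (ι n) s (ι n ^ℚ suc (2 ℕ.* j)) (cQInv (suc j) x) ⟩
    ι n ^ℚ suc (suc (2 ℕ.* j)) * (s * cQInv (suc j) x)
      ≡⟨ cong₂ (λ e z → ι n ^ℚ e * z) (sym (ℕ.*-suc 2 j)) (cQInv-closed j) ⟩
    ι n ^ℚ (2 ℕ.* suc j) * (a ^ℚ (2 ℕ.* suc j) - b ^ℚ (2 ℕ.* suc j))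
      ≡⟨ ι[1+k]^e*[a^e-b^e] (2 ℕ.* suc j) ⟩
    ι (suc n) ^ℚ (2 ℕ.* suc j) - 1ℚ ∎
    where
    open ≡-Reasoning
    regroup : ∀ (m s p q : ℚ) → m * s * p * q ≡ (m * p) * (s * q)
    regroup = solve-∀ ℚ-ring

-- The four identities

4m+2≡2[2m+1] : ∀ m → 4 ℕ.* m ℕ.+ 2 ≡ 2 ℕ.* (2 ℕ.* m ℕ.+ 1)
4m+2≡2[2m+1] = ℕ-Solver.solve-∀

private
  regroup₂ : ∀ (c Y Z d : ℚ) → c * (Y * Z) * d ≡ c * Y * Z * d
  regroup₂ = solve-∀ ℚ-ring

  regroup₃ : ∀ (c Y Z W d : ℚ) → c * (Y * Z * W) * d ≡ c * Y * Z * W * d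
  regroup₃ = solve-∀ ℚ-ring

  [S+[Y-1]]-S : ∀ (S Y : ℚ) → (S + (Y - 1ℚ)) - S ≡ Y - 1ℚ
  [S+[Y-1]]-S = solve-∀ ℚ-ring

  [S+[Y-1]]+S : ∀ (S Y : ℚ) → (S + (Y - 1ℚ)) + S ≡ (Y - 1ℚ) + (1ℚ + 1ℚ) * S
  [S+[Y-1]]+S = solve-∀ ℚ-ring

Σpow-odd : ∀ m n → 1 ≤ m →
  ι (4 ℕ.* m) * Σpow n (2 ℕ.* m ∸ 1)
    ≡ sumFrom 1 m (λ j → ι ((2 ℕ.* m) C (2 ℕ.* j ∸ 1)) * PInv (j ∸ 1) (uQ n) * B (2 ℕ.* m ℕ.+ 1 ∸ 2 ℕ.* j))
      + sumFrom 1 m (λ j → ι ((2 ℕ.* m) C (2 ℕ.* j)) * QInv j (uQ n) * B (2 ℕ.* m ∸ 2 ℕ.* j))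
Σpow-odd m n 1≤m = begin
  ι (4 ℕ.* m) * Σpow n (N ∸ 1)           ≡⟨ cong (λ c → ι c * Σpow n (N ∸ 1)) (ℕ.*-assoc 2 2 m) ⟩
  ι (2 ℕ.* N) * Σpow n (N ∸ 1)           ≡⟨ Σpow-Φ N n (ℕ.*-monoʳ-≤ 2 1≤m) ⟩
  Φ N F G                                ≡⟨ Φ-even m F G ⟩
  sumFrom 1 m odd + sumFrom 1 m even     ≡⟨ cong₂ _+_ (sumFrom-cong 1 m {odd} {odd′} odd≡) (sumFrom-cong 1 m {even} {even′} even≡) ⟩
  sumFrom 1 m odd′ + sumFrom 1 m even′   ∎
  where
  open ≡-Reasoning
  N : ℕ
  N = 2 ℕ.* m
  F G : ℕ → ℚ
  F e = ι (suc n) ^ℚ e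
  G e = ι n ^ℚ e
  odd even odd′ even′ : ℕ → ℚ
  odd j = ι (N C (2 ℕ.* j ∸ 1)) * (F (2 ℕ.* j ∸ 1) - G (2 ℕ.* j ∸ 1)) * B (N ℕ.+ 1 ∸ 2 ℕ.* j)
  even j = ι (N C (2 ℕ.* j)) * (F (2 ℕ.* j) + G (2 ℕ.* j)) * B (N ∸ 2 ℕ.* j)
  odd′ j = ι (N C (2 ℕ.* j ∸ 1)) * PInv (j ∸ 1) (uQ n) * B (N ℕ.+ 1 ∸ 2 ℕ.* j)
  even′ j = ι (N C (2 ℕ.* j)) * QInv j (uQ n) * B (N ∸ 2 ℕ.* j)
  odd≡ : ∀ j → odd (suc j) ≡ odd′ (suc j)
  odd≡ j = cong (λ X → ι (N C e) * X * B (N ℕ.+ 1 ∸ 2 ℕ.* suc j))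
                (subst (λ e → F e - G e ≡ PInv j (uQ n)) (sym (2[1+j]∸1≡1+2j j)) (sym (PInv-at-u n j)))
    where
    e : ℕ
    e = 2 ℕ.* suc j ∸ 1
  even≡ : ∀ j → even (suc j) ≡ even′ (suc j)
  even≡ j = cong (λ X → ι (N C (2 ℕ.* suc j)) * X * B (N ∸ 2 ℕ.* suc j)) (sym (QInv-at-u n j))

Σpow-even : ∀ m n → 1 ≤ m →
  ι (4 ℕ.* m ℕ.+ 2) * Σpow n (2 ℕ.* m)
    ≡ sumFrom 1 (m ℕ.+ 1) (λ j → ι ((2 ℕ.* m ℕ.+ 1) C (2 ℕ.* j ∸ 1)) * ι (2 ℕ.* n ℕ.+ 1) * cPInv (j ∸ 1) (uQ n) * B (2 ℕ.* m ℕ.+ 2 ∸ 2 ℕ.* j))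
      + sumFrom 1 m (λ j → ι ((2 ℕ.* m ℕ.+ 1) C (2 ℕ.* j)) * ι (2 ℕ.* n ℕ.+ 1) * cQInv j (uQ n) * B (2 ℕ.* m ℕ.+ 1 ∸ 2 ℕ.* j))
Σpow-even m n 1≤m = begin
  ι (4 ℕ.* m ℕ.+ 2) * Σpow n (2 ℕ.* m)        ≡⟨ cong₂ (λ c e → ι c * Σpow n e) (4m+2≡2[2m+1] m) (sym (ℕ.m+n∸n≡m (2 ℕ.* m) 1)) ⟩
  ι (2 ℕ.* N) * Σpow n (N ∸ 1)                ≡⟨ Σpow-Φ N n (ℕ.≤-trans (ℕ.*-monoʳ-≤ 2 1≤m) (ℕ.m≤m+n (2 ℕ.* m) 1)) ⟩
  Φ N F G                                     ≡⟨ Φ-odd m F G ⟩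
  sumFrom 1 (m ℕ.+ 1) odd + sumFrom 1 m even  ≡⟨ cong₂ _+_ (sumFrom-cong 1 (m ℕ.+ 1) {odd} {odd′} odd≡) (sumFrom-cong 1 m {even} {even′} even≡) ⟩
  sumFrom 1 (m ℕ.+ 1) odd′ + sumFrom 1 m even′ ∎
  where
  open ≡-Reasoning
  N : ℕ
  N = 2 ℕ.* m ℕ.+ 1
  F G : ℕ → ℚ
  F e = ι (suc n) ^ℚ e
  G e = ι n ^ℚ e
  odd even odd′ even′ : ℕ → ℚ
  odd j = ι (N C (2 ℕ.* j ∸ 1)) * (F (2 ℕ.* j ∸ 1) + G (2 ℕ.* j ∸ 1)) * B (2 ℕ.* m ℕ.+ 2 ∸ 2 ℕ.* j)
  even j = ι (N C (2 ℕ.* j)) * (F (2 ℕ.* j) - G (2 ℕ.* j)) * B (N ∸ 2 ℕ.* j)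
  odd′ j = ι (N C (2 ℕ.* j ∸ 1)) * ι (2 ℕ.* n ℕ.+ 1) * cPInv (j ∸ 1) (uQ n) * B (2 ℕ.* m ℕ.+ 2 ∸ 2 ℕ.* j)
  even′ j = ι (N C (2 ℕ.* j)) * ι (2 ℕ.* n ℕ.+ 1) * cQInv j (uQ n) * B (N ∸ 2 ℕ.* j)
  odd≡ : ∀ j → odd (suc j) ≡ odd′ (suc j)
  odd≡ j = trans (cong (λ X → ι (N C e) * X * B (2 ℕ.* m ℕ.+ 2 ∸ 2 ℕ.* suc j))
                       (subst (λ e → F e + G e ≡ ι (2 ℕ.* n ℕ.+ 1) * cPInv j (uQ n)) (sym (2[1+j]∸1≡1+2j j)) (sym (cPInv-at-u n j))))
                 (regroup₂ (ι (N C e)) (ι (2 ℕ.* n ℕ.+ 1)) (cPInv j (uQ n)) (B (2 ℕ.* m ℕ.+ 2 ∸ 2 ℕ.* suc j)))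
    where
    e : ℕ
    e = 2 ℕ.* suc j ∸ 1
  even≡ : ∀ j → even (suc j) ≡ even′ (suc j)
  even≡ j = trans (cong (λ X → ι (N C e) * X * B (N ∸ e)) (sym (cQInv-at-u n j)))
                  (regroup₂ (ι (N C e)) (ι (2 ℕ.* n ℕ.+ 1)) (cQInv (suc j) (uQ n)) (B (N ∸ e)))
    where
    e : ℕ
    e = 2 ℕ.* suc j

Σ²pow-odd : ∀ m n → 1 ≤ m → 1 ≤ n →
  ι (4 ℕ.* m) * Σ²pow n (2 ℕ.* m ∸ 1)
    ≡ sumFrom 1 m (λ j → ι ((2 ℕ.* m) C (2 ℕ.* j ∸ 1)) * (ι n ^ℚ (2 ℕ.* j ∸ 1)) * PInv (j ∸ 1) (vQ n) * B (2 ℕ.* m ℕ.+ 1 ∸ 2 ℕ.* j))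
      + sumFrom 1 m (λ j → ι ((2 ℕ.* m) C (2 ℕ.* j)) * (ι (n ℕ.+ 2) * (ι n ^ℚ (2 ℕ.* j ∸ 1)) * cQInv j (vQ n) + ι 2 * Σpow n (2 ℕ.* j)) * B (2 ℕ.* m ∸ 2 ℕ.* j))
Σ²pow-odd m n@(suc k) 1≤m _ = begin
  ι (4 ℕ.* m) * Σ²pow n (N ∸ 1)          ≡⟨ cong (λ c → ι c * Σ²pow n (N ∸ 1)) (ℕ.*-assoc 2 2 m) ⟩
  ι (2 ℕ.* N) * Σ²pow n (N ∸ 1)          ≡⟨ Σ²pow-Φ N n (ℕ.*-monoʳ-≤ 2 1≤m) ⟩
  Φ N F G                                ≡⟨ Φ-even m F G ⟩
  sumFrom 1 m odd + sumFrom 1 m even     ≡⟨ cong₂ _+_ (sumFrom-cong 1 m {odd} {odd′} odd≡) (sumFrom-cong 1 m {even} {even′} even≡) ⟩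
  sumFrom 1 m odd′ + sumFrom 1 m even′   ∎
  where
  open ≡-Reasoning
  N : ℕ
  N = 2 ℕ.* m
  F G : ℕ → ℚ
  F e = Σpow n e + (ι (suc n) ^ℚ e - 1ℚ)
  G e = Σpow n e
  odd even odd′ even′ : ℕ → ℚ
  odd j = ι (N C (2 ℕ.* j ∸ 1)) * (F (2 ℕ.* j ∸ 1) - G (2 ℕ.* j ∸ 1)) * B (N ℕ.+ 1 ∸ 2 ℕ.* j)
  even j = ι (N C (2 ℕ.* j)) * (F (2 ℕ.* j) + G (2 ℕ.* j)) * B (N ∸ 2 ℕ.* j)
  odd′ j = ι (N C (2 ℕ.* j ∸ 1)) * (ι n ^ℚ (2 ℕ.* j ∸ 1)) * PInv (j ∸ 1) (vQ n) * B (N ℕ.+ 1 ∸ 2 ℕ.* j)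
  even′ j = ι (N C (2 ℕ.* j)) * (ι (n ℕ.+ 2) * (ι n ^ℚ (2 ℕ.* j ∸ 1)) * cQInv j (vQ n) + ι 2 * Σpow n (2 ℕ.* j)) * B (N ∸ 2 ℕ.* j)
  odd≡ : ∀ j → odd (suc j) ≡ odd′ (suc j)
  odd≡ j = trans (cong (λ X → ι (N C e) * X * B (N ℕ.+ 1 ∸ 2 ℕ.* suc j))
                       (trans ([S+[Y-1]]-S (Σpow n e) (ι (suc n) ^ℚ e))
                              (subst (λ e → ι (suc n) ^ℚ e - 1ℚ ≡ ι n ^ℚ e * PInv j (vQ n)) (sym (2[1+j]∸1≡1+2j j)) (sym (PInv-at-v k j)))))
                 (regroup₂ (ι (N C e)) (ι n ^ℚ e) (PInv j (vQ n)) (B (N ℕ.+ 1 ∸ 2 ℕ.* suc j)))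
    where
    e : ℕ
    e = 2 ℕ.* suc j ∸ 1
  even≡ : ∀ j → even (suc j) ≡ even′ (suc j)
  even≡ j = cong (λ X → ι (N C e) * X * B (N ∸ e))
                 (trans ([S+[Y-1]]+S (Σpow n e) (ι (suc n) ^ℚ e))
                        (cong (_+ ι 2 * Σpow n e)
                              (subst (λ e′ → ι (suc n) ^ℚ e - 1ℚ ≡ ι (n ℕ.+ 2) * ι n ^ℚ e′ * cQInv (suc j) (vQ n)) (sym (2[1+j]∸1≡1+2j j)) (sym (cQInv-at-v k j)))))
    where
    e : ℕ
    e = 2 ℕ.* suc j

Σ²pow-even : ∀ m n → 1 ≤ m → 1 ≤ n →
  ι (4 ℕ.* m ℕ.+ 2) * Σ²pow n (2 ℕ.* m)
    ≡ sumFrom 1 (m ℕ.+ 1) (λ j → ι ((2 ℕ.* m ℕ.+ 1) C (2 ℕ.* j ∸ 1)) * ((ι n ^ℚ (2 ℕ.* j ∸ 1)) * PInv (j ∸ 1) (vQ n) + ι 2 * Σpow n (2 ℕ.* j ∸ 1)) * B (2 ℕ.* m ℕ.+ 2 ∸ 2 ℕ.* j))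
      + sumFrom 1 m (λ j → ι ((2 ℕ.* m ℕ.+ 1) C (2 ℕ.* j)) * ι (n ℕ.+ 2) * (ι n ^ℚ (2 ℕ.* j ∸ 1)) * cQInv j (vQ n) * B (2 ℕ.* m ℕ.+ 1 ∸ 2 ℕ.* j))
Σ²pow-even m n@(suc k) 1≤m _ = begin
  ι (4 ℕ.* m ℕ.+ 2) * Σ²pow n (2 ℕ.* m)       ≡⟨ cong₂ (λ c e → ι c * Σ²pow n e) (4m+2≡2[2m+1] m) (sym (ℕ.m+n∸n≡m (2 ℕ.* m) 1)) ⟩
  ι (2 ℕ.* N) * Σ²pow n (N ∸ 1)               ≡⟨ Σ²pow-Φ N n (ℕ.≤-trans (ℕ.*-monoʳ-≤ 2 1≤m) (ℕ.m≤m+n (2 ℕ.* m) 1)) ⟩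
  Φ N F G                                     ≡⟨ Φ-odd m F G ⟩
  sumFrom 1 (m ℕ.+ 1) odd + sumFrom 1 m even  ≡⟨ cong₂ _+_ (sumFrom-cong 1 (m ℕ.+ 1) {odd} {odd′} odd≡) (sumFrom-cong 1 m {even} {even′} even≡) ⟩
  sumFrom 1 (m ℕ.+ 1) odd′ + sumFrom 1 m even′ ∎
  where
  open ≡-Reasoning
  N : ℕ
  N = 2 ℕ.* m ℕ.+ 1
  F G : ℕ → ℚ
  F e = Σpow n e + (ι (suc n) ^ℚ e - 1ℚ)
  G e = Σpow n e
  odd even odd′ even′ : ℕ → ℚ
  odd j = ι (N C (2 ℕ.* j ∸ 1)) * (F (2 ℕ.* j ∸ 1) + G (2 ℕ.* j ∸ 1)) * B (2 ℕ.* m ℕ.+ 2 ∸ 2 ℕ.* j)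
  even j = ι (N C (2 ℕ.* j)) * (F (2 ℕ.* j) - G (2 ℕ.* j)) * B (N ∸ 2 ℕ.* j)
  odd′ j = ι (N C (2 ℕ.* j ∸ 1)) * ((ι n ^ℚ (2 ℕ.* j ∸ 1)) * PInv (j ∸ 1) (vQ n) + ι 2 * Σpow n (2 ℕ.* j ∸ 1)) * B (2 ℕ.* m ℕ.+ 2 ∸ 2 ℕ.* j)
  even′ j = ι (N C (2 ℕ.* j)) * ι (n ℕ.+ 2) * (ι n ^ℚ (2 ℕ.* j ∸ 1)) * cQInv j (vQ n) * B (N ∸ 2 ℕ.* j)
  odd≡ : ∀ j → odd (suc j) ≡ odd′ (suc j)
  odd≡ j = cong (λ X → ι (N C e) * X * B (2 ℕ.* m ℕ.+ 2 ∸ 2 ℕ.* suc j))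
                (trans ([S+[Y-1]]+S (Σpow n e) (ι (suc n) ^ℚ e))
                       (cong (_+ ι 2 * Σpow n e)
                             (subst (λ e → ι (suc n) ^ℚ e - 1ℚ ≡ ι n ^ℚ e * PInv j (vQ n)) (sym (2[1+j]∸1≡1+2j j)) (sym (PInv-at-v k j)))))
    where
    e : ℕ
    e = 2 ℕ.* suc j ∸ 1
  even≡ : ∀ j → even (suc j) ≡ even′ (suc j)
  even≡ j = trans (cong (λ X → ι (N C e) * X * B (N ∸ e))
                        (trans ([S+[Y-1]]-S (Σpow n e) (ι (suc n) ^ℚ e))
                               (subst (λ e′ → ι (suc n) ^ℚ e - 1ℚ ≡ ι (n ℕ.+ 2) * ι n ^ℚ e′ * cQInv (suc j) (vQ n)) (sym (2[1+j]∸1≡1+2j j)) (sym (cQInv-at-v k j)))))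
                  (regroup₃ (ι (N C e)) (ι (n ℕ.+ 2)) (ι n ^ℚ (2 ℕ.* suc j ∸ 1)) (cQInv (suc j) (vQ n)) (B (N ∸ e)))
    where
    e : ℕ
    e = 2 ℕ.* suc j

theorem5 : (m n : ℕ) → 1 ≤ m → 1 ≤ n →
    (ι (4 ℕ.* m) * Σpow n (2 ℕ.* m ∸ 1)
      ≡ sumFrom 1 m (λ j → ι ((2 ℕ.* m) C (2 ℕ.* j ∸ 1)) * PInv (j ∸ 1) (uQ n) * B (2 ℕ.* m ℕ.+ 1 ∸ 2 ℕ.* j))
        + sumFrom 1 m (λ j → ι ((2 ℕ.* m) C (2 ℕ.* j)) * QInv j (uQ n) * B (2 ℕ.* m ∸ 2 ℕ.* j)))
    × (ι (4 ℕ.* m ℕ.+ 2) * Σpow n (2 ℕ.* m)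
      ≡ sumFrom 1 (m ℕ.+ 1) (λ j → ι ((2 ℕ.* m ℕ.+ 1) C (2 ℕ.* j ∸ 1)) * ι (2 ℕ.* n ℕ.+ 1) * cPInv (j ∸ 1) (uQ n) * B (2 ℕ.* m ℕ.+ 2 ∸ 2 ℕ.* j))
        + sumFrom 1 m (λ j → ι ((2 ℕ.* m ℕ.+ 1) C (2 ℕ.* j)) * ι (2 ℕ.* n ℕ.+ 1) * cQInv j (uQ n) * B (2 ℕ.* m ℕ.+ 1 ∸ 2 ℕ.* j)))
    × (ι (4 ℕ.* m) * Σ²pow n (2 ℕ.* m ∸ 1)
      ≡ sumFrom 1 m (λ j → ι ((2 ℕ.* m) C (2 ℕ.* j ∸ 1)) * (ι n ^ℚ (2 ℕ.* j ∸ 1)) * PInv (j ∸ 1) (vQ n) * B (2 ℕ.* m ℕ.+ 1 ∸ 2 ℕ.* j))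
        + sumFrom 1 m (λ j → ι ((2 ℕ.* m) C (2 ℕ.* j)) * (ι (n ℕ.+ 2) * (ι n ^ℚ (2 ℕ.* j ∸ 1)) * cQInv j (vQ n) + ι 2 * Σpow n (2 ℕ.* j)) * B (2 ℕ.* m ∸ 2 ℕ.* j)))
    × (ι (4 ℕ.* m ℕ.+ 2) * Σ²pow n (2 ℕ.* m)
      ≡ sumFrom 1 (m ℕ.+ 1) (λ j → ι ((2 ℕ.* m ℕ.+ 1) C (2 ℕ.* j ∸ 1)) * ((ι n ^ℚ (2 ℕ.* j ∸ 1)) * PInv (j ∸ 1) (vQ n) + ι 2 * Σpow n (2 ℕ.* j ∸ 1)) * B (2 ℕ.* m ℕ.+ 2 ∸ 2 ℕ.* j))
        + sumFrom 1 m (λ j → ι ((2 ℕ.* m ℕ.+ 1) C (2 ℕ.* j)) * ι (n ℕ.+ 2) * (ι n ^ℚ (2 ℕ.* j ∸ 1)) * cQInv j (vQ n) * B (2 ℕ.* m ℕ.+ 1 ∸ 2 ℕ.* j)))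
theorem5 m n 1≤m 1≤n = Σpow-odd m n 1≤m , Σpow-even m n 1≤m , Σ²pow-odd m n 1≤m 1≤n , Σ²pow-even m n 1≤m 1≤n
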